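{- Up to graph isomorphism, there are exactly six connected $2$-graphs of positive curvature.
   Context: All graphs are finite simple graphs. For a vertex $x$ of a graph $G$, the unit sphere $S(x)$ is the subgraph induced by the neighbors of $x$, and $G-x$ is the subgraph induced by all vertices other than $x$. Inductive definitions: the empty graph is the $(-1)$-sphere; the one-vertex graph is contractible; a graph $G$ is contractible if it has a vertex $x$ such that $S(x)$ and $G-x$ are contractible. A $d$-graph is a graph in which every $S(x)$ is a $(d-1)$-sphere; a $d$-sphere is a $d$-graph $G$ with a vertex $x$ such that $G-x$ is contractible. (Thus a $1$-sphere is a cycle $C_n$ with $n\ge 4$ and a $2$-graph is a graph in which every unit sphere is such a cycle.) A wheel graph is a cone over a cycle $C_n$, $n \geq 4$, whose $n$ cycle vertices are its boundary points; it is embedded in $G$ if it is a subgraph of $G$ equal to the subgraph of $G$ induced by its vertex set. A $2$-graph has positive curvature if every embedded wheel graph has fewer than $6$ boundary points; equivalently every vertex has degree $4$ or $5$. -}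

module Defs where

open import Data.Nat using (ℕ; zero; suc; _+_; _<_; _%_)
open import Data.Fin using (Fin; toℕ; _≟_)
open import Data.Bool using (Bool; true; false; _∧_; not)
open import Data.Product using (Σ; _×_; _,_; ∃)
open import Data.Sum using (_⊎_)
open import Relation.Nullary.Decidable using (⌊_⌋)
open import Relation.Binary.PropositionalEquality using (_≡_)
open import Function.Bundles using (_↔_; _⇔_; Inverse)
open import Function.Definitions using (Injective)

record Graph : Set where
  field
    n      : ℕ
    adj    : Fin n → Fin n → Bool
    sym    : ∀ i j → adj i j ≡ adj j i
    irrefl : ∀ i → adj i i ≡ false
open Graph public

_≅_ : Graph → Graph → Set
G ≅ H = Σ (Fin (n G) ↔ Fin (n H)) λ f →
          ∀ i j → adj H (Inverse.to f i) (Inverse.to f j) ≡ adj G i j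

-- Induced subgraphs of a fixed ambient graph G are given by vertex
-- subsets U : Fin (n G) → Bool.

module _ (G : Graph) where

  VSet : Set
  VSet = Fin (n G) → Bool

  remove : VSet → Fin (n G) → VSet
  remove U x y = U y ∧ not ⌊ y ≟ x ⌋

  unitSphere : VSet → Fin (n G) → VSet
  unitSphere U x y = U y ∧ adj G x y

  IsEmpty : VSet → Set
  IsEmpty U = ∀ y → U y ≡ false

  data Contractible : VSet → Set where
    point : ∀ {U} x → U x ≡ true → (∀ y → U y ≡ true → y ≡ x) →
            Contractible U
    step  : ∀ {U} x → U x ≡ true →
            Contractible (unitSphere U x) → Contractible (remove U x) →
            Contractible U

  -- IsSphere k U  : G[U] is a (k-1)-sphere
  -- IsDGraph k U  : G[U] is a k-graph (every unit sphere is a (k-1)-sphere)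
  IsSphere : ℕ → VSet → Set
  IsDGraph : ℕ → VSet → Set
  IsSphere zero    U = IsEmpty U
  IsSphere (suc k) U = IsDGraph k U × Σ (Fin (n G)) λ x → U x ≡ true × Contractible (remove U x)
  IsDGraph k U = ∀ x → U x ≡ true → IsSphere k (unitSphere U x)

  data Reachable : Fin (n G) → Fin (n G) → Set where
    here  : ∀ {u} → Reachable u u
    there : ∀ {u w v} → adj G u w ≡ true → Reachable w v → Reachable u v

all : (G : Graph) → VSet G
all G _ = true

TwoGraph : Graph → Set
TwoGraph G = IsDGraph G 2 (all G)

Connected : Graph → Set
Connected G = 0 < n G × (∀ u v → Reachable G u v)

-- Embedded wheel graphs: a cone with centre c over a cycle C_k
-- (k = 4 + m boundary points b 0, ..., b (k-1)), equal to the subgraph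
-- of G induced by its vertex set.

CycAdj : (m : ℕ) → Fin (4 + m) → Fin (4 + m) → Set
CycAdj m i j = (suc (toℕ i) % (4 + m) ≡ toℕ j) ⊎ (suc (toℕ j) % (4 + m) ≡ toℕ i)

record EmbeddedWheel (G : Graph) (m : ℕ) : Set where
  field
    centre   : Fin (n G)
    boundary : Fin (4 + m) → Fin (n G)
    inj      : Injective _≡_ _≡_ boundary
    spokes   : ∀ i → adj G centre (boundary i) ≡ true
    rim      : ∀ i j → (adj G (boundary i) (boundary j) ≡ true) ⇔ CycAdj m i j

PositiveCurvature : Graph → Set
PositiveCurvature G = ∀ m → EmbeddedWheel G m → 4 + m < 6

module Submission where

open import Defs
open import Data.Nat using (ℕ)
open import Data.Fin using (Fin)
open import Data.Product using (Σ; _×_; ∃; _,_)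
open import Relation.Binary.PropositionalEquality using (_≡_)

-- That they are connected 2-graphs
-- is established by certified finite searches, evaluated by the type checker;
-- positive curvature follows from maximum degree 5, because the boundary of
-- an embedded wheel consists of distinct neighbours of its centre.  They are
-- pairwise non-isomorphic because their vertex counts differ.
--
-- Completeness rests on two local facts about a 2-graph G: the common
-- neighbours of an edge are exactly two vertices, and walking around the unit
-- sphere of a vertex a closes up into a cycle through all neighbours of a
-- that bounds an embedded wheel, so under positive curvature S(a) is a
-- 4-cycle or a 5-cycle.  A finite certificate records a symbolic exploration
-- of an unknown G, starting from a triangle: open the unit sphere of a named
-- vertex (branching on its length), identify vertices forced equal by the
-- edge fact, record non-adjacencies forced by completely known unit spheres,
-- and close each branch by a contradiction or by a map from one of the six
-- graphs that is injective, preserves edges and is onto every neighbourhood.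
-- Since G is connected, such a map is an isomorphism.  A Boolean checker
-- validates the certificate by evaluation; its soundness proof gives the
-- classification.

open import Data.Nat using (zero; suc; _+_; _*_; _∸_; _<_; _≤_; _≤?_; z≤n; s≤s; _%_; _/_; _≡ᵇ_; _<ᵇ_)
import Data.Nat.Properties as ℕₚ
open import Data.Nat.DivMod using (m%n<n; m≡m%n+[m/n]*n; n%n≡0; m<n⇒m%n≡m)
open import Data.Fin using (toℕ; fromℕ<; _≟_; #_)
open import Data.Fin.Properties using (toℕ-injective; toℕ<n; pigeonhole; <⇒≢; any?)
open import Data.Fin.Permutation using (↔⇒≡)
open import Data.Bool using (Bool; true; false; _∧_; _∨_; not; if_then_else_; T?)
open import Data.Bool.Properties using (T-≡; ∨-comm)
import Data.Bool.Properties as Boolₚ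
open import Data.Maybe using (Maybe; just; nothing; _>>=_; zip; from-just)
open import Data.List using (List; []; _∷_; _++_; filter; allFin)
open import Data.Vec using (Vec; []; _∷_; lookup)
import Data.List as List
open import Data.List.Relation.Unary.All as All using (All; []; _∷_)
import Data.List.Relation.Unary.All.Properties as Allₚ
open import Data.List.Relation.Unary.Any as Any using (Any; here; there)
import Data.List.Relation.Unary.Any.Properties as Anyₚ
open import Data.List.Membership.Propositional.Properties using (∈-upTo⁺)
open import Data.Product using (proj₁; proj₂)
open import Data.Sum using (_⊎_; inj₁; inj₂)
open import Function using (_∘_)
open import Function.Bundles using (Equivalence; mk⇔; mk↔ₛ′)
open import Relation.Nullary using (¬_; Dec; yes; no)
open import Relation.Nullary.Negation using (contradiction)
open import Relation.Nullary.Decidable using (⌊_⌋; _×-dec_; _⊎-dec_; ¬?; from-yes)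
import Relation.Nullary.Decidable as Dec
open import Relation.Binary using (tri<; tri≈; tri>)
open import Relation.Binary.PropositionalEquality
  using (_≢_; refl; trans; cong; cong₂; subst; subst₂)
import Relation.Binary.PropositionalEquality as ≡

true≢false : true ≢ false
true≢false ()

∧-split : ∀ a {b} → a ∧ b ≡ true → a ≡ true × b ≡ true
∧-split true e = refl , e

∧-elimˡ : ∀ {a b} → a ∧ b ≡ true → a ≡ true
∧-elimˡ {a} e = proj₁ (∧-split a e)

∧-elimʳ : ∀ {a b} → a ∧ b ≡ true → b ≡ true
∧-elimʳ {a} e = proj₂ (∧-split a e)

∧-intro : ∀ {a b} → a ≡ true → b ≡ true → a ∧ b ≡ true
∧-intro refl refl = refl

∨-elim : ∀ {a b} → a ∨ b ≡ true → a ≡ true ⊎ b ≡ true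
∨-elim {true} _ = inj₁ refl
∨-elim {false} e = inj₂ e

≡ᵇ-sound : ∀ m n → (m ≡ᵇ n) ≡ true → m ≡ n
≡ᵇ-sound m n e = ℕₚ.≡ᵇ⇒≡ m n (Equivalence.from T-≡ e)

any-within : {X : Set} {P Q R : X → Set} → (∀ {x} → P x → Q x → R x)
  → ∀ {xs} → Any P xs → All Q xs → Any R xs
any-within f (here p) (q ∷ _) = here (f p q)
any-within f (there p) (_ ∷ qs) = there (any-within f p qs)

-- A search returns `just` a proof or gives up;
-- run on concrete data by the type checker and unpacked with from-just, it
-- establishes the finite facts about the six graphs.

allM : ∀ m {P : Fin m → Set} → ((i : Fin m) → Maybe (P i)) → Maybe (∀ i → P i)
allM zero f = just (λ ())
allM (suc m) {P} f with f Fin.zero | allM m {λ i → P (Fin.suc i)} (λ i → f (Fin.suc i))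
... | just p | just ps = just (λ { Fin.zero → p ; (Fin.suc i) → ps i })
... | _ | _ = nothing

anyM : ∀ m {P : Fin m → Set} → ((i : Fin m) → Maybe (P i)) → Maybe (Σ (Fin m) P)
anyM zero f = nothing
anyM (suc m) {P} f with f Fin.zero
... | just p = just (Fin.zero , p)
... | nothing with anyM m {λ i → P (Fin.suc i)} (λ i → f (Fin.suc i))
...   | just (i , p) = just (Fin.suc i , p)
...   | nothing = nothing

isTrue : (b : Bool) → Maybe (b ≡ true)
isTrue true = just refl
isTrue false = nothing

isFalse : (b : Bool) → Maybe (b ≡ false)
isFalse false = just refl
isFalse true = nothing

fromDec : {P : Set} → Dec P → Maybe P
fromDec (yes p) = just p
fromDec (no _) = nothing

module GraphFacts (G : Graph) where

  V : Set
  V = Fin (n G)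

  A : V → V → Bool
  A = adj G

  adj-sym : ∀ {x y} → A x y ≡ true → A y x ≡ true
  adj-sym {x} {y} e = trans (Graph.sym G y x) e

  adj⇒≢ : ∀ {x y} → A x y ≡ true → x ≢ y
  adj⇒≢ {x} e refl = true≢false (trans (≡.sym e) (irrefl G x))

  separated : ∀ {x y z} → A x z ≡ true → A y z ≡ false → x ≢ y
  separated xz yz refl = true≢false (trans (≡.sym xz) yz)

  kept⇒≢ : ∀ {x y : V} → not ⌊ y ≟ x ⌋ ≡ true → y ≢ x
  kept⇒≢ {x} {y} e with y ≟ x
  kept⇒≢ () | yes _
  ... | no y≢x = y≢x

  ≢⇒kept : ∀ {x y : V} → y ≢ x → not ⌊ y ≟ x ⌋ ≡ true
  ≢⇒kept {x} {y} y≢x with y ≟ x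
  ... | yes y≡x = contradiction y≡x y≢x
  ... | no _ = refl

  contractible-inhabited : ∀ {U} → Contractible G U → Σ V λ x → U x ≡ true
  contractible-inhabited (point x ux _) = x , ux
  contractible-inhabited (step x ux _ _) = x , ux

  edgeless-contractible : ∀ {U} → Contractible G U
    → (∀ x y → U x ≡ true → U y ≡ true → A x y ≡ false)
    → Σ V λ z → U z ≡ true × (∀ y → U y ≡ true → y ≡ z)
  edgeless-contractible (point x ux only) _ = x , ux , only
  edgeless-contractible {U} (step x ux sphere _) edgeless
    with s , us ← contractible-inhabited sphere
    = contradiction (trans (≡.sym (∧-elimʳ {U s} us)) (edgeless x s ux (∧-elimˡ us))) true≢false

  record TwoPoints (U : VSet G) : Set where
    field
      p q : V
      p≢q : p ≢ q
      up : U p ≡ true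
      uq : U q ≡ true
      only : ∀ y → U y ≡ true → y ≡ p ⊎ y ≡ q
      noEdge : ∀ x y → U x ≡ true → U y ≡ true → A x y ≡ false

  zeroSphere-twoPoints : ∀ {U} → IsSphere G 1 U → TwoPoints U
  zeroSphere-twoPoints {U} (isolated , x , ux , rest) = record
    { p = x ; q = z ; p≢q = λ e → kept⇒≢ {x} {z} (∧-elimʳ {U z} uz) (≡.sym e)
    ; up = ux ; uq = ∧-elimˡ uz ; only = only ; noEdge = noEdge }
    where
    noEdge : ∀ x y → U x ≡ true → U y ≡ true → A x y ≡ false
    noEdge x y ux uy with isolated x ux y
    ... | e rewrite uy = e
    point-rest : Σ V λ z → remove G U x z ≡ true × (∀ y → remove G U x y ≡ true → y ≡ z)
    point-rest = edgeless-contractible rest (λ a b ea eb → noEdge a b (∧-elimˡ ea) (∧-elimˡ eb))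
    z : V
    z = proj₁ point-rest
    uz : remove G U x z ≡ true
    uz = proj₁ (proj₂ point-rest)
    only : ∀ y → U y ≡ true → y ≡ x ⊎ y ≡ z
    only y uy with y ≟ x
    ... | yes e = inj₁ e
    ... | no ne = inj₂ (proj₂ (proj₂ point-rest) y (∧-intro uy (≢⇒kept ne)))

  -- contractible graphs are connected: a property that holds at one vertex
  -- and propagates along edges holds at every vertex
  contractible-connected : ∀ {U} → Contractible G U → (C : V → Set)
    → (∀ y z → U y ≡ true → U z ≡ true → A y z ≡ true → C y → C z)
    → (y₀ : V) → U y₀ ≡ true → C y₀ → ∀ y → U y ≡ true → C y
  contractible-connected (point x ux only) C _ y₀ u₀ c₀ y uy =
    subst C (trans (only y₀ u₀) (≡.sym (only y uy))) c₀
  contractible-connected {U} (step x ux sphere rest) C spread y₀ u₀ c₀ = everywhere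
    where
    s : V
    s = proj₁ (contractible-inhabited sphere)
    us : U s ≡ true
    us = ∧-elimˡ (proj₂ (contractible-inhabited sphere))
    xs : A x s ≡ true
    xs = ∧-elimʳ {U s} (proj₂ (contractible-inhabited sphere))
    s-kept : remove G U x s ≡ true
    s-kept = ∧-intro us (≢⇒kept (λ e → adj⇒≢ xs (≡.sym e)))
    start : Σ V λ y → remove G U x y ≡ true × C y
    start with y₀ ≟ x
    ... | yes e = s , s-kept , spread x s ux us xs (subst C e c₀)
    ... | no ne = y₀ , ∧-intro u₀ (≢⇒kept ne) , c₀
    inRest : ∀ y → remove G U x y ≡ true → C y
    inRest = contractible-connected rest C (λ y z ey ez → spread y z (∧-elimˡ ey) (∧-elimˡ ez))
               (proj₁ start) (proj₁ (proj₂ start)) (proj₂ (proj₂ start))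
    everywhere : ∀ y → U y ≡ true → C y
    everywhere y uy with y ≟ x
    ... | yes refl = spread s x us ux (adj-sym xs) (inRest s s-kept)
    ... | no ne = inRest y (∧-intro uy (≢⇒kept ne))

  DegreeAtMost : ℕ → V → Set
  DegreeAtMost d c = Σ (Fin d → V) λ f → ∀ y → A c y ≡ true → Σ (Fin d) λ t → f t ≡ y

  -- the boundary of an embedded wheel consists of distinct neighbours of
  -- its centre, so it is no larger than the degree bound
  wheel≤degree : ∀ {d m} → (∀ c → DegreeAtMost d c) → EmbeddedWheel G m → 4 + m ≤ d
  wheel≤degree {d} {m} deg w with 4 + m ≤? d
  ... | yes fits = fits
  ... | no tooBig =
    let i , j , i<j , same = pigeonhole (ℕₚ.≰⇒> tooBig) slot
    in contradiction (W.inj (trans (≡.sym (enumerate-slot i)) (trans (cong enumerate same) (enumerate-slot j)))) (<⇒≢ i<j)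
    where
    module W = EmbeddedWheel w
    enumerate : Fin d → V
    enumerate = proj₁ (deg W.centre)
    slot : Fin (4 + m) → Fin d
    slot i = proj₁ (proj₂ (deg W.centre) (W.boundary i) (W.spokes i))
    enumerate-slot : ∀ i → enumerate (slot i) ≡ W.boundary i
    enumerate-slot i = proj₂ (proj₂ (deg W.centre) (W.boundary i) (W.spokes i))

  degree≤5⇒positiveCurvature : (∀ c → DegreeAtMost 5 c) → PositiveCurvature G
  degree≤5⇒positiveCurvature deg m w = s≤s (wheel≤degree deg w)

lookupOr : {X : Set} → List X → ℕ → X → X
lookupOr [] _ d = d
lookupOr (x ∷ xs) zero d = x
lookupOr (x ∷ xs) (suc t) d = lookupOr xs t d

module Search (G : Graph) where
  open GraphFacts G

  findPoint : (U : VSet G) → Maybe (Contractible G U)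
  findPoint U = anyM (n G) (λ x → isTrue (U x)) >>= λ (x , ux) →
                allM (n G) (onlyAt x) >>= λ only → just (point x ux only)
    where
    onlyAt : (x y : V) → Maybe (U y ≡ true → y ≡ x)
    onlyAt x y with y ≟ x | U y
    ... | yes y≡x | _ = just (λ _ → y≡x)
    ... | no _ | false = just (λ ())
    ... | no _ | true = nothing

  findContractible : (fuel : ℕ) → (U : VSet G) → Maybe (Contractible G U)
  findContractible zero U = nothing
  findContractible (suc fuel) U with findPoint U
  ... | just p = just p
  ... | nothing = anyM (n G) stepAt >>= λ (_ , c) → just c
    where
    stepAt : V → Maybe (Contractible G U)
    stepAt x = isTrue (U x) >>= λ ux →
               findContractible fuel (unitSphere G U x) >>= λ cS →
               findContractible fuel (remove G U x) >>= λ cR → just (step x ux cS cR)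

  findSphere : (k : ℕ) → (U : VSet G) → Maybe (IsSphere G k U)
  findDGraph : (k : ℕ) → (U : VSet G) → Maybe (IsDGraph G k U)
  findSphere zero U = allM (n G) (λ y → isFalse (U y))
  findSphere (suc k) U = zip (findDGraph k U)
    (anyM (n G) (λ x → zip (isTrue (U x)) (findContractible (suc (n G)) (remove G U x))))
  findDGraph k U = allM (n G) (λ x → atVertex x (U x) refl)
    where
    atVertex : (x : V) (b : Bool) → U x ≡ b → Maybe (U x ≡ true → IsSphere G k (unitSphere G U x))
    atVertex x false ux = just (λ ux' → contradiction (trans (≡.sym ux') ux) true≢false)
    atVertex x true _ = findSphere k (unitSphere G U x) >>= λ s → just (λ _ → s)

  findPath : (fuel : ℕ) → (u v : V) → Maybe (Reachable G u v)
  findPath fuel u v with u ≟ v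
  ... | yes refl = just here
  findPath zero u v | no _ = nothing
  findPath (suc fuel) u v | no _ = anyM (n G) viaNeighbour >>= λ (_ , r) → just r
    where
    viaNeighbour : V → Maybe (Reachable G u v)
    viaNeighbour w = isTrue (A u w) >>= λ uw → findPath fuel w v >>= λ r → just (there uw r)

  findDegreeBound : (d : ℕ) (c : V) → Maybe (DegreeAtMost d c)
  findDegreeBound d c = allM (n G) (λ y → isListed y (A c y) refl) >>= λ h → just (neighbour , h)
    where
    neighbour : Fin d → V
    neighbour t = lookupOr (filter (λ y → T? (A c y)) (allFin (n G))) (toℕ t) c
    isListed : (y : V) (b : Bool) → A c y ≡ b → Maybe (A c y ≡ true → Σ (Fin d) λ t → neighbour t ≡ y)
    isListed y false cy = just (λ cy' → contradiction (trans (≡.sym cy') cy) true≢false)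
    isListed y true _ = anyM d (λ t → fromDec (neighbour t ≟ y)) >>= λ p → just (λ _ → p)

-- CyclicNeighbours g s t says that s and t
-- are consecutive on the cycle 0, 1, …, g-1; on indices below g it agrees
-- with the relation CycAdj of Defs, which is phrased with remainders.

CyclicNeighbours : ℕ → ℕ → ℕ → Set
CyclicNeighbours g s t = (suc s ≡ t) ⊎ (suc t ≡ s) ⊎ (suc s ≡ g × t ≡ 0) ⊎ (suc t ≡ g × s ≡ 0)

suc-mod : ∀ g′ x → x < suc g′
  → (suc x < suc g′ × suc x % suc g′ ≡ suc x) ⊎ (suc x ≡ suc g′ × suc x % suc g′ ≡ 0)
suc-mod g′ x x<g with suc x ℕₚ.≟ suc g′
... | yes wraps = inj₂ (wraps , subst (λ y → y % suc g′ ≡ 0) (≡.sym wraps) (n%n≡0 (suc g′)))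
... | no stays = inj₁ (ℕₚ.≤∧≢⇒< x<g stays , m<n⇒m%n≡m (ℕₚ.≤∧≢⇒< x<g stays))

cyclic⇒mod : ∀ g′ s t → s < suc g′ → t < suc g′ → CyclicNeighbours (suc g′) s t
  → (suc s % suc g′ ≡ t) ⊎ (suc t % suc g′ ≡ s)
cyclic⇒mod g′ s t s<g t<g (inj₁ e) with suc-mod g′ s s<g
... | inj₁ (_ , q) = inj₁ (trans q e)
... | inj₂ (p , _) = contradiction (trans (≡.sym e) p) (ℕₚ.<⇒≢ t<g)
cyclic⇒mod g′ s t s<g t<g (inj₂ (inj₁ e)) with suc-mod g′ t t<g
... | inj₁ (_ , q) = inj₂ (trans q e)
... | inj₂ (p , _) = contradiction (trans (≡.sym e) p) (ℕₚ.<⇒≢ s<g)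
cyclic⇒mod g′ s t s<g t<g (inj₂ (inj₂ (inj₁ (e , refl)))) with suc-mod g′ s s<g
... | inj₁ (p , _) = contradiction e (ℕₚ.<⇒≢ p)
... | inj₂ (_ , q) = inj₁ q
cyclic⇒mod g′ s t s<g t<g (inj₂ (inj₂ (inj₂ (e , refl)))) with suc-mod g′ t t<g
... | inj₁ (p , _) = contradiction e (ℕₚ.<⇒≢ p)
... | inj₂ (_ , q) = inj₂ q

mod⇒cyclic : ∀ g′ s t → s < suc g′ → t < suc g′ → (suc s % suc g′ ≡ t) ⊎ (suc t % suc g′ ≡ s)
  → CyclicNeighbours (suc g′) s t
mod⇒cyclic g′ s t s<g t<g (inj₁ e) with suc-mod g′ s s<g
... | inj₁ (_ , q) = inj₁ (trans (≡.sym q) e)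
... | inj₂ (p , q) = inj₂ (inj₂ (inj₁ (p , trans (≡.sym e) q)))
mod⇒cyclic g′ s t s<g t<g (inj₂ e) with suc-mod g′ t t<g
... | inj₁ (_ , q) = inj₂ (inj₁ (trans (≡.sym q) e))
... | inj₂ (p , q) = inj₂ (inj₂ (inj₂ (p , trans (≡.sym e) q)))

least-witness : {P : ℕ → Set} → (∀ g → Dec (P g)) → ∀ g → P g
  → Σ ℕ λ g → P g × (∀ j → j < g → ¬ P j)
least-witness {P} P? g pg = go g 0 (λ _ ()) pg
  where
  -- invariant: no witness below k, and k + b is a witness
  go : ∀ b k → (∀ j → j < k → ¬ P j) → P (k + b) → Σ ℕ λ g → P g × (∀ j → j < g → ¬ P j)
  go b k below p with P? k
  ... | yes pk = k , pk , below
  go zero k below p | no ¬pk = contradiction (subst P (ℕₚ.+-identityʳ k) p) ¬pk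
  go (suc b) k below p | no ¬pk = go b (suc k) below′ (subst P (ℕₚ.+-suc k b) p)
    where
    below′ : ∀ j → j < suc k → ¬ P j
    below′ j (s≤s j≤k) with j ℕₚ.≟ k
    ... | yes refl = ¬pk
    ... | no j≢k = below j (ℕₚ.≤∧≢⇒< j≤k j≢k)

pick : ∀ {m} (f : Fin m → Bool) → Fin m → Fin m
pick f d with any? (λ x → f x Boolₚ.≟ true)
... | yes (x , _) = x
... | no _ = d

pick-spec : ∀ {m} (f : Fin m → Bool) (d z : Fin m) → f z ≡ true → f (pick f d) ≡ true
pick-spec f d z fz with any? (λ x → f x Boolₚ.≟ true)
... | yes (_ , fx) = fx
... | no none = contradiction (z , fz) none

-- The local structure of a 2-graph: every edge lies in exactly two
-- triangles, and the unit sphere of every vertex is a single cycle.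

module TwoGraphStructure (G : Graph) (two : TwoGraph G) where
  open GraphFacts G

  Common : V → V → VSet G
  Common a b z = A a z ∧ A b z

  -- S(b) inside S(a) is a 0-sphere, so an edge has exactly two common neighbours
  edge-twoPoints : ∀ a b → A a b ≡ true → TwoPoints (Common a b)
  edge-twoPoints a b ab = zeroSphere-twoPoints (proj₁ (two a refl) b ab)

  third-common-unique : ∀ {a b c x y} → A a b ≡ true → A a c ≡ true → A b c ≡ true
    → A a x ≡ true → A b x ≡ true → A a y ≡ true → A b y ≡ true → x ≢ c → y ≢ c → x ≡ y
  third-common-unique {a} {b} {c} {x} {y} ab ac bc ax bx ay by x≢c y≢c
    with T.only c (∧-intro ac bc) | T.only x (∧-intro ax bx) | T.only y (∧-intro ay by)
    where module T = TwoPoints (edge-twoPoints a b ab)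
  ... | inj₁ c≡p | inj₁ x≡p | _ = contradiction (trans x≡p (≡.sym c≡p)) x≢c
  ... | inj₁ c≡p | _ | inj₁ y≡p = contradiction (trans y≡p (≡.sym c≡p)) y≢c
  ... | inj₁ _ | inj₂ x≡q | inj₂ y≡q = trans x≡q (≡.sym y≡q)
  ... | inj₂ c≡q | inj₂ x≡q | _ = contradiction (trans x≡q (≡.sym c≡q)) x≢c
  ... | inj₂ c≡q | _ | inj₂ y≡q = contradiction (trans y≡q (≡.sym c≡q)) y≢c
  ... | inj₂ _ | inj₁ x≡p | inj₁ y≡p = trans x≡p (≡.sym y≡p)

  triangle-at : (v : V) → Σ V λ i → Σ V λ j → A v i ≡ true × A v j ≡ true × A i j ≡ true
  triangle-at v = x , T.p , vx , ∧-elimˡ T.up , ∧-elimʳ {A v T.p} T.up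
    where
    x : V
    x = proj₁ (proj₂ (two v refl))
    vx : A v x ≡ true
    vx = proj₁ (proj₂ (proj₂ (two v refl)))
    module T = TwoPoints (edge-twoPoints v x vx)

  module Walk (a i j : V) (ai : A a i ≡ true) (aj : A a j ≡ true) (ij : A i j ≡ true) where

    Continues : V → V → V → Bool
    Continues p c z = A a z ∧ (A c z ∧ not ⌊ z ≟ p ⌋)

    walk : ℕ → V
    walk zero = i
    walk (suc zero) = j
    walk (suc (suc t)) = pick (Continues (walk t) (walk (suc t))) (walk t)

    Triangle : ℕ → Set
    Triangle t = A a (walk t) ≡ true × A a (walk (suc t)) ≡ true × A (walk t) (walk (suc t)) ≡ true

    continues : ∀ t → Triangle t → Continues (walk t) (walk (suc t)) (walk (suc (suc t))) ≡ true
    continues t (at , at′ , e) = pick-spec (Continues (walk t) (walk (suc t))) (walk t) z cz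
      where
      module T = TwoPoints (edge-twoPoints a (walk (suc t)) at′)
      other : Σ V λ z → Common a (walk (suc t)) z ≡ true × z ≢ walk t
      other with T.only (walk t) (∧-intro at (adj-sym e))
      ... | inj₁ e₁ = T.q , T.uq , λ e₂ → T.p≢q (≡.sym (trans e₂ e₁))
      ... | inj₂ e₁ = T.p , T.up , λ e₂ → T.p≢q (trans e₂ e₁)
      z : V
      z = proj₁ other
      cz : Continues (walk t) (walk (suc t)) z ≡ true
      cz = ∧-intro {A a z} (∧-elimˡ (proj₁ (proj₂ other)))
             (∧-intro {A (walk (suc t)) z} (∧-elimʳ {A a z} (proj₁ (proj₂ other))) (≢⇒kept (proj₂ (proj₂ other))))

    triangle : ∀ t → Triangle t
    triangle zero = ai , aj , ij
    triangle (suc t) = at′ , ∧-elimˡ c , ∧-elimˡ (∧-elimʳ {A a (walk (suc (suc t)))} c)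
      where
      at′ : A a (walk (suc t)) ≡ true
      at′ = proj₁ (proj₂ (triangle t))
      c : Continues (walk t) (walk (suc t)) (walk (suc (suc t))) ≡ true
      c = continues t (triangle t)

    in-link : ∀ t → A a (walk t) ≡ true
    in-link t = proj₁ (triangle t)

    walk-edge : ∀ t → A (walk t) (walk (suc t)) ≡ true
    walk-edge t = proj₂ (proj₂ (triangle t))

    no-backtrack : ∀ t → walk (suc (suc t)) ≢ walk t
    no-backtrack t = kept⇒≢ (∧-elimʳ {A (walk (suc t)) (walk (suc (suc t)))}
                              (∧-elimʳ {A a (walk (suc (suc t)))} (continues t (triangle t))))

    link-neighbours : ∀ t z → A a z ≡ true → A (walk (suc t)) z ≡ true
      → z ≡ walk t ⊎ z ≡ walk (suc (suc t))
    link-neighbours t z az bz with z ≟ walk t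
    ... | yes e = inj₁ e
    ... | no ne = inj₂ (third-common-unique (in-link (suc t)) (in-link t) (adj-sym (walk-edge t))
                          az bz (in-link (suc (suc t))) (walk-edge (suc t)) ne (no-backtrack t))

    -- S(a) has no triangles, so the walk has no chords of length two
    no-short-chord : ∀ t → A (walk t) (walk (suc (suc t))) ≡ false
    no-short-chord t = T.noEdge (walk t) (walk (suc (suc t)))
                         (∧-intro (in-link t) (adj-sym (walk-edge t)))
                         (∧-intro (in-link (suc (suc t))) (walk-edge (suc t)))
      where module T = TwoPoints (edge-twoPoints a (walk (suc t)) (in-link (suc t)))

    repeat⇒return : ∀ t s → s < t → walk s ≡ walk t → Σ ℕ λ g → 0 < g × g ≤ t × walk 0 ≡ walk g
    repeat⇒return t zero s<t e = t , s<t , ℕₚ.≤-refl , e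
    repeat⇒return (suc t′) (suc s′) (s≤s s′<t′) e with t′ ℕₚ.≟ suc s′
    ... | yes refl = contradiction e (adj⇒≢ (walk-edge (suc s′)))
    ... | no ne₁ with t′ ℕₚ.≟ suc (suc s′)
    ...   | yes refl = contradiction (≡.sym e) (no-backtrack (suc s′))
    ...   | no ne₂ with link-neighbours s′ (walk t′) (in-link t′)
                          (subst (λ x → A x (walk t′) ≡ true) (≡.sym e) (adj-sym (walk-edge t′)))
    ...     | inj₁ e₁ = let g , p , q , r = repeat⇒return t′ s′ s′<t′ (≡.sym e₁)
                        in g , p , ℕₚ.m≤n⇒m≤1+n q , r
    ...     | inj₂ e₂ = let g , p , q , r = repeat⇒return t′ (suc (suc s′)) lt (≡.sym e₂)
                        in g , p , ℕₚ.m≤n⇒m≤1+n q , r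
      where
      lt : suc (suc s′) < t′
      lt = ℕₚ.≤∧≢⇒< (ℕₚ.≤∧≢⇒< s′<t′ (ne₁ ∘ ≡.sym)) (ne₂ ∘ ≡.sym)

    Returns : ℕ → Set
    Returns g = 0 < g × walk g ≡ walk 0

    returns? : ∀ g → Dec (Returns g)
    returns? zero = no (λ ())
    returns? (suc g) with walk (suc g) ≟ walk 0
    ... | yes e = yes (s≤s z≤n , e)
    ... | no ne = no (ne ∘ proj₂)

    period≥4 : ∀ g′ → Returns (suc g′) → 3 ≤ g′
    period≥4 zero (_ , e) = contradiction (≡.sym e) (adj⇒≢ (walk-edge 0))
    period≥4 (suc zero) (_ , e) = contradiction e (no-backtrack 0)
    period≥4 (suc (suc zero)) (_ , e) =
      contradiction (trans (≡.sym (adj-sym (subst (λ x → A (walk 2) x ≡ true) e (walk-edge 2)))) (no-short-chord 0))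
                    true≢false
    period≥4 (suc (suc (suc k))) _ = s≤s (s≤s (s≤s z≤n))

    -- Cut at its first return time g, the walk is a g-cycle through all of
    -- S(a) with no chords: the boundary of an embedded wheel centred at a.
    module FirstReturn (g′ : ℕ) (returns : Returns (suc g′)) (first : ∀ j → j < suc g′ → ¬ Returns j) where

      g : ℕ
      g = suc g′

      distinct : ∀ s t → s < t → t < g → walk s ≢ walk t
      distinct s t s<t t<g e with repeat⇒return t s s<t e
      ... | h , 0<h , h≤t , back = first h (ℕₚ.≤-<-trans h≤t t<g) (0<h , ≡.sym back)

      walk-injective : ∀ s t → s < g → t < g → walk s ≡ walk t → s ≡ t
      walk-injective s t s<g t<g e with ℕₚ.<-cmp s t
      ... | tri< s<t _ _ = contradiction e (distinct s t s<t t<g)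
      ... | tri≈ _ s≡t _ = s≡t
      ... | tri> _ _ t<s = contradiction (≡.sym e) (distinct t s t<s s<g)

      periodic : ∀ t → walk (t + g) ≡ walk t
      periodic zero = proj₂ returns
      periodic (suc zero)
        with link-neighbours g′ (walk 1) (in-link 1)
               (subst (λ x → A x (walk 1) ≡ true) (≡.sym (proj₂ returns)) (walk-edge 0))
      ... | inj₁ e = contradiction e (distinct 1 g′ (ℕₚ.≤-trans (s≤s (s≤s z≤n)) (period≥4 g′ returns)) (ℕₚ.n<1+n g′))
      ... | inj₂ e = ≡.sym e
      periodic (suc (suc t)) = cong₂ (λ p c → pick (Continues p c) p) (periodic t) (periodic (suc t))

      periodic* : ∀ q r → walk (r + q * g) ≡ walk r
      periodic* zero r = cong walk (ℕₚ.+-identityʳ r)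
      periodic* (suc q) r = begin
        walk (r + (g + q * g))  ≡⟨ cong walk (trans (cong (r +_) (ℕₚ.+-comm g (q * g))) (≡.sym (ℕₚ.+-assoc r (q * g) g))) ⟩
        walk (r + q * g + g)    ≡⟨ periodic (r + q * g) ⟩
        walk (r + q * g)        ≡⟨ periodic* q r ⟩
        walk r                  ∎
        where open ≡.≡-Reasoning

      reduce : ∀ t → Σ ℕ λ s → s < g × walk s ≡ walk t
      reduce t = t % g , m%n<n t g ,
        ≡.sym (trans (cong walk (m≡m%n+[m/n]*n t g)) (periodic* (t / g) (t % g)))

      periodic′ : ∀ t → walk (suc (t + g′)) ≡ walk t
      periodic′ t = trans (cong walk (≡.sym (ℕₚ.+-suc t g′))) (periodic t)

      OnWalk : V → Set
      OnWalk z = Σ ℕ λ t → walk t ≡ z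

      onWalk-spreads : ∀ y z → A a y ≡ true → A a z ≡ true → A y z ≡ true → OnWalk y → OnWalk z
      onWalk-spreads y z ay az yz (t , e)
        with link-neighbours (t + g′) z az (subst (λ x → A x z ≡ true) (≡.sym (trans (periodic′ t) e)) yz)
      ... | inj₁ e₁ = t + g′ , ≡.sym e₁
      ... | inj₂ e₂ = suc (suc (t + g′)) , ≡.sym e₂

      -- S(a) is a 1-sphere, hence S(a) minus a point is contractible and so
      -- connected; the walk therefore reaches every neighbour of a
      covers : ∀ z → A a z ≡ true → Σ ℕ λ s → s < g × walk s ≡ z
      covers z az = let s , s<g , e = reduce (proj₁ onWalk) in s , s<g , trans e (proj₂ onWalk)
        where
        x₀ : V
        x₀ = proj₁ (proj₂ (two a refl))
        S-x₀ : VSet G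
        S-x₀ = remove G (unitSphere G (all G) a) x₀
        inRest : ∀ y → S-x₀ y ≡ true → OnWalk y
        inRest = contractible-connected (proj₂ (proj₂ (proj₂ (two a refl)))) OnWalk
                   (λ y z ey ez → onWalk-spreads y z (∧-elimˡ ey) (∧-elimˡ ez)) (proj₁ start) (proj₁ (proj₂ start)) (proj₂ (proj₂ start))
          where
          start : Σ V λ y → S-x₀ y ≡ true × OnWalk y
          start with walk 0 ≟ x₀
          ... | no ne = walk 0 , ∧-intro {A a (walk 0)} (in-link 0) (≢⇒kept ne) , 0 , refl
          ... | yes e = walk 1 , ∧-intro {A a (walk 1)} (in-link 1) (≢⇒kept (λ e′ → adj⇒≢ (walk-edge 0) (trans e (≡.sym e′)))) , 1 , refl
        onWalk : OnWalk z
        onWalk with z ≟ x₀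
        ... | no ne = inRest z (∧-intro {A a z} az (≢⇒kept ne))
        ... | yes refl = onWalk-spreads T.p z (∧-elimˡ T.up) az (adj-sym (∧-elimʳ {A a T.p} T.up))
                           (inRest T.p (∧-intro {A a T.p} (∧-elimˡ T.up) (≢⇒kept (λ e → adj⇒≢ (∧-elimʳ {A a T.p} T.up) (≡.sym e)))))
          where module T = TwoPoints (edge-twoPoints a z az)

      rim⇒cyclic : ∀ s t → s < g → t < g → A (walk s) (walk t) ≡ true → CyclicNeighbours g s t
      rim⇒cyclic s t s<g t<g e
        with link-neighbours (s + g′) (walk t) (in-link t) (subst (λ x → A x (walk t) ≡ true) (≡.sym (periodic′ s)) e)
      rim⇒cyclic zero t s<g t<g e | inj₁ e₁ =
        inj₂ (inj₂ (inj₂ (cong suc (walk-injective t g′ t<g (ℕₚ.n<1+n g′) e₁) , refl)))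
      rim⇒cyclic (suc s′) t s<g t<g e | inj₁ e₁ =
        inj₂ (inj₁ (cong suc (walk-injective t s′ t<g (ℕₚ.<-trans (ℕₚ.n<1+n s′) s<g) (trans e₁ (periodic′ s′)))))
      rim⇒cyclic s t s<g t<g e | inj₂ e₂ with suc s ℕₚ.≟ g
      ... | yes wraps = inj₂ (inj₂ (inj₁ (wraps , walk-injective t 0 t<g (s≤s z≤n)
              (trans e₂ (trans (cong walk (cong suc (≡.sym (ℕₚ.+-suc s g′))))
                (trans (periodic (suc s)) (trans (cong walk wraps) (proj₂ returns))))))))
      ... | no stays = inj₁ (≡.sym (walk-injective t (suc s) t<g (ℕₚ.≤∧≢⇒< s<g stays)
              (trans e₂ (trans (cong walk (cong suc (≡.sym (ℕₚ.+-suc s g′)))) (periodic (suc s))))))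

      cyclic⇒rim : ∀ s t → CyclicNeighbours g s t → A (walk s) (walk t) ≡ true
      cyclic⇒rim s t (inj₁ refl) = walk-edge s
      cyclic⇒rim s t (inj₂ (inj₁ refl)) = adj-sym (walk-edge t)
      cyclic⇒rim s t (inj₂ (inj₂ (inj₁ (e , refl)))) =
        subst (λ x → A (walk s) x ≡ true) (trans (cong walk e) (proj₂ returns)) (walk-edge s)
      cyclic⇒rim s t (inj₂ (inj₂ (inj₂ (e , refl)))) =
        adj-sym (subst (λ x → A (walk t) x ≡ true) (trans (cong walk e) (proj₂ returns)) (walk-edge t))

      wheel : ∀ m → 4 + m ≡ g → EmbeddedWheel G m
      wheel m 4+m≡g = record
        { centre = a
        ; boundary = λ k → walk (toℕ k)
        ; inj = λ {x} {y} e → toℕ-injective (walk-injective _ _ (bound x) (bound y) e)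
        ; spokes = λ k → in-link (toℕ k)
        ; rim = λ x y → mk⇔
            (λ xy → cyclic⇒mod (3 + m) (toℕ x) (toℕ y) (toℕ<n x) (toℕ<n y)
                      (subst (λ h → CyclicNeighbours h (toℕ x) (toℕ y)) (≡.sym 4+m≡g) (rim⇒cyclic _ _ (bound x) (bound y) xy)))
            (λ xy → cyclic⇒rim _ _ (subst (λ h → CyclicNeighbours h (toℕ x) (toℕ y)) 4+m≡g
                      (mod⇒cyclic (3 + m) (toℕ x) (toℕ y) (toℕ<n x) (toℕ<n y) xy)))
        }
        where
        bound : (x : Fin (4 + m)) → toℕ x < g
        bound x = subst (toℕ x <_) 4+m≡g (toℕ<n x)

      length-4-or-5 : PositiveCurvature G → g ≡ 4 ⊎ g ≡ 5
      length-4-or-5 pc with period≥4 g′ returns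
      ... | s≤s (s≤s (s≤s {n = m} z≤n)) with pc m (wheel m refl)
      ...   | s≤s (s≤s (s≤s (s≤s (s≤s z≤n)))) = inj₁ refl
      ...   | s≤s (s≤s (s≤s (s≤s (s≤s (s≤s z≤n))))) = inj₂ refl

    record ShortCycle : Set where
      field
        length : ℕ
        length-4-or-5 : length ≡ 4 ⊎ length ≡ 5
        covers : ∀ z → A a z ≡ true → Σ ℕ λ s → s < length × walk s ≡ z
        rim⇒cyclic : ∀ s t → s < length → t < length → A (walk s) (walk t) ≡ true → CyclicNeighbours length s t
        cyclic⇒rim : ∀ s t → CyclicNeighbours length s t → A (walk s) (walk t) ≡ true
        walk-injective : ∀ s t → s < length → t < length → walk s ≡ walk t → s ≡ t

    short-cycle : PositiveCurvature G → ShortCycle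
    short-cycle pc with pigeonhole (ℕₚ.n<1+n (n G)) (λ k → walk (toℕ k))
    ... | x , y , x<y , e with repeat⇒return (toℕ y) (toℕ x) x<y e
    ...   | h , 0<h , _ , back with least-witness returns? h (0<h , ≡.sym back)
    ...     | zero , (() , _) , _
    ...     | suc g′ , returns , first = record
              { length = suc g′ ; length-4-or-5 = length-4-or-5 pc ; covers = covers
              ; rim⇒cyclic = rim⇒cyclic ; cyclic⇒rim = cyclic⇒rim ; walk-injective = walk-injective }
      where open FirstReturn g′ returns first

-- A map φ from a non-empty graph H to a connected graph G that is injective,
-- preserves edges and maps every neighbourhood onto the neighbourhood of the
-- image is an isomorphism: paths of G lift through φ, so φ is onto.
local-isomorphism⇒≅ : (G H : Graph) (φ : Fin (n H) → Fin (n G))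
  → (∀ v w → adj H v w ≡ true → adj G (φ v) (φ w) ≡ true)
  → (∀ v y → adj G (φ v) y ≡ true → Σ (Fin (n H)) λ w → adj H v w ≡ true × φ w ≡ y)
  → (∀ v w → φ v ≡ φ w → v ≡ w)
  → Fin (n H) → (∀ u v → Reachable G u v) → G ≅ H
local-isomorphism⇒≅ G H φ preserves onto injective v₀ connected = mk↔ₛ′ ψ φ φ-inverse ψ-inverse , adjacency
  where
  Image : Fin (n G) → Set
  Image y = Σ (Fin (n H)) λ v → φ v ≡ y

  lift : ∀ {u y} → Reachable G u y → Image u → Image y
  lift here p = p
  lift (there {w = w} uw r) (v , refl) = let x , vx , φx = onto v w uw in lift r (x , φx)

  preimage : ∀ y → Image y
  preimage y = lift (connected (φ v₀) y) (v₀ , refl)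

  ψ : Fin (n G) → Fin (n H)
  ψ y = proj₁ (preimage y)

  ψ-inverse : ∀ y → φ (ψ y) ≡ y
  ψ-inverse y = proj₂ (preimage y)

  φ-inverse : ∀ v → ψ (φ v) ≡ v
  φ-inverse v = injective _ _ (ψ-inverse (φ v))

  adjacency : ∀ x y → adj H (ψ x) (ψ y) ≡ adj G x y
  adjacency x y with adj H (ψ x) (ψ y) in hxy
  ... | true = ≡.sym (subst₂ (λ u v → adj G u v ≡ true) (ψ-inverse x) (ψ-inverse y) (preserves _ _ hxy))
  ... | false with adj G x y in gxy
  ...   | false = refl
  ...   | true = contradiction (trans (≡.sym hxw) (trans (cong (adj H (ψ x)) w≡ψy) hxy)) true≢false
    where
    lifted : Σ (Fin (n H)) λ w → adj H (ψ x) w ≡ true × φ w ≡ y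
    lifted = onto (ψ x) y (subst (λ u → adj G u y ≡ true) (≡.sym (ψ-inverse x)) gxy)
    hxw : adj H (ψ x) (proj₁ lifted) ≡ true
    hxw = proj₁ (proj₂ lifted)
    w≡ψy : proj₁ lifted ≡ ψ y
    w≡ψy = injective _ _ (trans (proj₂ (proj₂ lifted)) (≡.sym (ψ-inverse y)))

listed : ℕ → ℕ → List (ℕ × ℕ) → Bool
listed a b [] = false
listed a b ((x , y) ∷ es) = ((a ≡ᵇ x) ∧ (b ≡ᵇ y)) ∨ listed a b es

edgeListAdj : ∀ m → List (ℕ × ℕ) → Fin m → Fin m → Bool
edgeListAdj m es i j = listed (toℕ i) (toℕ j) es ∨ listed (toℕ j) (toℕ i) es

fromEdges : ∀ m (es : List (ℕ × ℕ)) → (∀ i → edgeListAdj m es i i ≡ false) → Graph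
fromEdges m es loopless = record
  { n = m ; adj = edgeListAdj m es
  ; sym = λ i j → ∨-comm (listed (toℕ i) (toℕ j) es) (listed (toℕ j) (toℕ i) es)
  ; irrefl = loopless }

-- The six deltahedra with vertex degrees 4 and 5, as (vertex count, edges):
-- octahedron, pentagonal bipyramid, snub disphenoid, triaugmented
-- triangular prism, gyroelongated square bipyramid, icosahedron.
deltahedronData : Vec (ℕ × List (ℕ × ℕ)) 6
deltahedronData =
  (6 , (0 , 2) ∷ (0 , 3) ∷ (0 , 4) ∷ (0 , 5) ∷ (1 , 2) ∷ (1 , 3) ∷ (1 , 4) ∷ (1 , 5)
     ∷ (2 , 3) ∷ (3 , 4) ∷ (4 , 5) ∷ (5 , 2) ∷ []) ∷
  (7 , (0 , 2) ∷ (0 , 3) ∷ (0 , 4) ∷ (0 , 5) ∷ (0 , 6) ∷ (1 , 2) ∷ (1 , 3) ∷ (1 , 4) ∷ (1 , 5) ∷ (1 , 6)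
     ∷ (2 , 3) ∷ (3 , 4) ∷ (4 , 5) ∷ (5 , 6) ∷ (6 , 2) ∷ []) ∷
  (8 , (0 , 1) ∷ (0 , 2) ∷ (0 , 3) ∷ (0 , 4) ∷ (1 , 2) ∷ (1 , 4) ∷ (1 , 5) ∷ (2 , 3) ∷ (2 , 5) ∷ (2 , 6)
     ∷ (3 , 4) ∷ (3 , 6) ∷ (3 , 7) ∷ (4 , 5) ∷ (4 , 7) ∷ (5 , 6) ∷ (5 , 7) ∷ (6 , 7) ∷ []) ∷
  (9 , (0 , 1) ∷ (1 , 2) ∷ (2 , 0) ∷ (3 , 4) ∷ (4 , 5) ∷ (5 , 3) ∷ (0 , 3) ∷ (1 , 4) ∷ (2 , 5)
     ∷ (6 , 0) ∷ (6 , 1) ∷ (6 , 3) ∷ (6 , 4) ∷ (7 , 1) ∷ (7 , 2) ∷ (7 , 4) ∷ (7 , 5)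
     ∷ (8 , 2) ∷ (8 , 0) ∷ (8 , 5) ∷ (8 , 3) ∷ []) ∷
  (10 , (0 , 1) ∷ (0 , 2) ∷ (0 , 3) ∷ (0 , 4) ∷ (1 , 2) ∷ (2 , 3) ∷ (3 , 4) ∷ (4 , 1)
      ∷ (5 , 6) ∷ (6 , 7) ∷ (7 , 8) ∷ (8 , 5) ∷ (9 , 5) ∷ (9 , 6) ∷ (9 , 7) ∷ (9 , 8)
      ∷ (1 , 5) ∷ (2 , 6) ∷ (3 , 7) ∷ (4 , 8) ∷ (1 , 6) ∷ (2 , 7) ∷ (3 , 8) ∷ (4 , 5) ∷ []) ∷
  (12 , (0 , 1) ∷ (0 , 2) ∷ (0 , 3) ∷ (0 , 4) ∷ (0 , 5) ∷ (1 , 2) ∷ (2 , 3) ∷ (3 , 4) ∷ (4 , 5) ∷ (5 , 1)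
      ∷ (6 , 7) ∷ (7 , 8) ∷ (8 , 9) ∷ (9 , 10) ∷ (10 , 6) ∷ (11 , 6) ∷ (11 , 7) ∷ (11 , 8) ∷ (11 , 9) ∷ (11 , 10)
      ∷ (1 , 6) ∷ (2 , 7) ∷ (3 , 8) ∷ (4 , 9) ∷ (5 , 10) ∷ (1 , 7) ∷ (2 , 8) ∷ (3 , 9) ∷ (4 , 10) ∷ (5 , 6) ∷ []) ∷
  []

order : Fin 6 → ℕ
order t = proj₁ (lookup deltahedronData t)

edgeList : Fin 6 → List (ℕ × ℕ)
edgeList t = proj₂ (lookup deltahedronData t)

loopless : ∀ t (i : Fin (order t)) → edgeListAdj (order t) (edgeList t) i i ≡ false
loopless = from-just (allM 6 λ t → allM (order t) λ i → isFalse (edgeListAdj (order t) (edgeList t) i i))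

deltahedron : Fin 6 → Graph
deltahedron t = fromEdges (order t) (edgeList t) (loopless t)

-- the three properties, verified by search; every vertex is within
-- distance 3 of every other, so paths of length 3 suffice
verify : (G : Graph) → Maybe (Connected G × TwoGraph G × PositiveCurvature G)
verify G = zip (zip (fromDec (1 ≤? n G)) (allM (n G) λ u → allM (n G) λ v → findPath 3 u v))
               (zip (findDGraph 2 (all G))
                    (allM (n G) (findDegreeBound 5) >>= λ deg → just (degree≤5⇒positiveCurvature deg)))
  where
  open Search G
  open GraphFacts G

deltahedron-properties : ∀ t → Connected (deltahedron t) × TwoGraph (deltahedron t) × PositiveCurvature (deltahedron t)
deltahedron-properties = from-just (allM 6 λ t → verify (deltahedron t))

-- isomorphic graphs have equally many vertices, and the vertex counts differ
order-injective : ∀ t u → order t ≡ order u → t ≡ u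
order-injective = from-just (allM 6 λ t → allM 6 λ u → distinguish t u)
  where
  distinguish : (t u : Fin 6) → Maybe (order t ≡ order u → t ≡ u)
  distinguish t u with t ≟ u | order t ℕₚ.≟ order u
  ... | yes t≡u | _ = just (λ _ → t≡u)
  ... | no _ | no different = just (λ same → contradiction same different)
  ... | no _ | yes _ = nothing

deltahedra-distinct : ∀ t u → deltahedron t ≅ deltahedron u → t ≡ u
deltahedra-distinct t u (f , _) = order-injective t u (↔⇒≡ f)

-- Vertices are named by numbers
-- below `named`; the lists record known edges, known non-edges, pairs known
-- to be distinct, and vertices whose complete neighbourhood is known.

record Knowledge : Set where
  constructor knowledge
  field
    named : ℕ
    edges nonEdges unequal : List (ℕ × ℕ)
    links : List (ℕ × List ℕ)
open Knowledge

data Apart : Set where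
  byEdge : Apart
  recorded : Apart
  separatedBy : ℕ → Apart      -- x is adjacent to z but y is not
  separatedBy′ : ℕ → Apart     -- y is adjacent to z but x is not

data Step : Set where
  -- x and y are common neighbours of the edge a b, both distinct from c,
  -- and a b c is a triangle; hence x = y, and y is renamed to x
  identify : (a b c x y : ℕ) → Apart → Apart → Step
  -- the neighbourhood of a is completely known (link number l) and x is
  -- apart from all of it; hence x is not adjacent to a
  nonAdjacent : (a x l : ℕ) → List Apart → Step

data Certificate : Set where
  _▸_ : Step → Certificate → Certificate
  -- a i j is a triangle: name the unit sphere of a, which is the cycle
  -- i, j, … of length 4 (first subtree) or 5 (second subtree)
  openLink : (a i j : ℕ) → Certificate → Certificate → Certificate
  clash : (x y : ℕ) → Certificate
  -- deltahedron t maps onto the named vertices: vertex v goes to name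
  -- σ[v], whose neighbourhood is link number lks[v]; ev[v][w] shows that
  -- the names of distinct v and w are apart
  match : Fin 6 → (σ lks : List ℕ) → (ev : List (List Apart)) → Certificate

infixr 5 _▸_

allB : {X : Set} → (X → Bool) → List X → Bool
allB p [] = true
allB p (x ∷ xs) = p x ∧ allB p xs

knownEdge knownNonEdge : Knowledge → ℕ → ℕ → Bool
knownEdge s x y = listed x y (edges s) ∨ listed y x (edges s)
knownNonEdge s x y = listed x y (nonEdges s) ∨ listed y x (nonEdges s)

knownEdges : Knowledge → List (ℕ × ℕ) → Bool
knownEdges s = allB (λ p → knownEdge s (proj₁ p) (proj₂ p))

apart? : Knowledge → ℕ → ℕ → Apart → Bool
apart? s x y byEdge = knownEdge s x y
apart? s x y recorded = listed x y (unequal s) ∨ listed y x (unequal s)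
apart? s x y (separatedBy z) = knownEdge s x z ∧ knownNonEdge s y z
apart? s x y (separatedBy′ z) = knownNonEdge s x z ∧ knownEdge s y z

apartAll? : Knowledge → ℕ → List ℕ → List Apart → Bool
apartAll? s x [] [] = true
apartAll? s x (w ∷ ws) (e ∷ es) = apart? s x w e ∧ apartAll? s x ws es
apartAll? s x _ _ = false

lookupMaybe : {X : Set} → List X → ℕ → Maybe X
lookupMaybe [] _ = nothing
lookupMaybe (x ∷ xs) zero = just x
lookupMaybe (x ∷ xs) (suc t) = lookupMaybe xs t

linkAt : Knowledge → ℕ → Maybe (ℕ × List ℕ)
linkAt s l = lookupMaybe (links s) l

rename : ℕ → ℕ → ℕ → ℕ
rename y x t = if t ≡ᵇ y then x else t

renamePair : ℕ → ℕ → ℕ × ℕ → ℕ × ℕ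
renamePair y x (u , v) = rename y x u , rename y x v

renameKnowledge : ℕ → ℕ → Knowledge → Knowledge
renameKnowledge y x s = knowledge (named s)
  (List.map (renamePair y x) (edges s)) (List.map (renamePair y x) (nonEdges s))
  (List.map (renamePair y x) (unequal s))
  (List.map (λ (a , ws) → rename y x a , List.map (rename y x) ws) (links s))

addNonEdge : ℕ → ℕ → Knowledge → Knowledge
addNonEdge a x s = knowledge (named s) (edges s) ((a , x) ∷ nonEdges s) (unequal s) (links s)

pairBelow : ℕ → ℕ × ℕ → Bool
pairBelow m (u , v) = (u <ᵇ m) ∧ (v <ᵇ m)

linkBelow : ℕ → ℕ × List ℕ → Bool
linkBelow m (a , ws) = (a <ᵇ m) ∧ allB (_<ᵇ m) ws

namesBelow : ℕ → Knowledge → Bool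
namesBelow m s = allB (pairBelow m) (edges s) ∧ (allB (pairBelow m) (nonEdges s) ∧
                 (allB (pairBelow m) (unequal s) ∧ allB (linkBelow m) (links s)))

-- The d-cycle on the indices 0, …, d-1 (d = 4 or 5): its edges, and the
-- remaining pairs of distinct indices.
cycleEdges cycleNonEdges : ℕ → List (ℕ × ℕ)
cycleEdges 4 = (0 , 1) ∷ (1 , 2) ∷ (2 , 3) ∷ (0 , 3) ∷ []
cycleEdges _ = (0 , 1) ∷ (1 , 2) ∷ (2 , 3) ∷ (3 , 4) ∷ (0 , 4) ∷ []
cycleNonEdges 4 = (0 , 2) ∷ (1 , 3) ∷ []
cycleNonEdges _ = (0 , 2) ∷ (0 , 3) ∷ (1 , 3) ∷ (1 , 4) ∷ (2 , 4) ∷ []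

linkName : ℕ → ℕ → ℕ → ℕ → ℕ
linkName i j k zero = i
linkName i j k (suc zero) = j
linkName i j k (suc (suc t)) = k + t

linkNamePair : ℕ → ℕ → ℕ → ℕ × ℕ → ℕ × ℕ
linkNamePair i j k (u , v) = linkName i j k u , linkName i j k v

openLinkOf : ℕ → Knowledge → ℕ → ℕ → ℕ → Knowledge
openLinkOf d s a i j = knowledge (named s + (d ∸ 2))
  (List.map (λ u → a , linkName i j (named s) u) (List.upTo d)
    ++ (List.map (linkNamePair i j (named s)) (cycleEdges d) ++ edges s))
  (List.map (linkNamePair i j (named s)) (cycleNonEdges d) ++ nonEdges s)
  (List.map (linkNamePair i j (named s)) (cycleEdges d)
    ++ (List.map (linkNamePair i j (named s)) (cycleNonEdges d) ++ unequal s))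
  ((a , List.map (linkName i j (named s)) (List.upTo d)) ∷ links s)

identifyEdges : (a b c x y : ℕ) → List (ℕ × ℕ)
identifyEdges a b c x y = (a , b) ∷ (a , c) ∷ (b , c) ∷ (a , x) ∷ (b , x) ∷ (a , y) ∷ (b , y) ∷ []

identify-ok : Knowledge → (a b c x y : ℕ) → Apart → Apart → Bool
identify-ok s a b c x y ex ey = knownEdges s (identifyEdges a b c x y) ∧ (apart? s x c ex ∧ apart? s y c ey)

-- a i j must be a known triangle, and the fresh names must be unused
openLink-ok : Knowledge → (a i j : ℕ) → Bool
openLink-ok s a i j = knownEdges s ((a , i) ∷ (a , j) ∷ (i , j) ∷ []) ∧ namesBelow (named s) s

nonAdjacent-ok : Knowledge → (a x l : ℕ) → List Apart → Bool
nonAdjacent-ok s a x l evs with linkAt s l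
... | nothing = false
... | just (a′ , ws) = (a ≡ᵇ a′) ∧ apartAll? s x ws evs

allᶠ : ∀ m → (Fin m → Bool) → Bool
allᶠ zero p = true
allᶠ (suc m) p = p Fin.zero ∧ allᶠ m (p ∘ Fin.suc)

anyᶠ : ∀ m → (Fin m → Bool) → Bool
anyᶠ zero p = false
anyᶠ (suc m) p = p Fin.zero ∨ anyᶠ m (p ∘ Fin.suc)

module Match (s : Knowledge) (t : Fin 6) (σ lks : List ℕ) (ev : List (List Apart)) where
  N : ℕ
  N = order t

  H : Graph
  H = deltahedron t

  σ[_] : Fin N → ℕ
  σ[ v ] = lookupOr σ (toℕ v) 0

  apartness : Fin N → Fin N → Apart
  apartness v w = lookupOr (lookupOr ev (toℕ v) []) (toℕ w) byEdge

  edgesKnown : Bool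
  edgesKnown = allᶠ N (λ v → allᶠ N (λ w → not (adj H v w) ∨ knownEdge s σ[ v ] σ[ w ]))

  linkCovered : Fin N → Bool
  linkCovered v with linkAt s (lookupOr lks (toℕ v) 0)
  ... | nothing = false
  ... | just (a′ , ws) = (σ[ v ] ≡ᵇ a′) ∧ allB (λ u → anyᶠ N (λ w → adj H v w ∧ (σ[ w ] ≡ᵇ u))) ws

  namesApart : Bool
  namesApart = allᶠ N (λ v → allᶠ N (λ w → (toℕ v ≡ᵇ toℕ w) ∨ apart? s σ[ v ] σ[ w ] (apartness v w)))

  matches : Bool
  matches = edgesKnown ∧ (allᶠ N linkCovered ∧ namesApart)

valid : Knowledge → Certificate → Bool
valid s (identify a b c x y ex ey ▸ rest) = identify-ok s a b c x y ex ey ∧ valid (renameKnowledge y x s) rest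
valid s (nonAdjacent a x l evs ▸ rest) = nonAdjacent-ok s a x l evs ∧ valid (addNonEdge a x s) rest
valid s (openLink a i j c₄ c₅) = openLink-ok s a i j ∧ (valid (openLinkOf 4 s a i j) c₄ ∧ valid (openLinkOf 5 s a i j) c₅)
valid s (clash x y) = knownEdge s x y ∧ knownNonEdge s x y
valid s (match t σ lks ev) = Match.matches s t σ lks ev

triangle₀ : Knowledge
triangle₀ = knowledge 3 ((0 , 1) ∷ (0 , 2) ∷ (1 , 2) ∷ []) [] [] []

InCycle : ℕ → (ℕ × ℕ) → Set
InCycle d (u , v) = u < d × v < d × u ≢ v

record CycleShape (d : ℕ) : Set where
  field
    cycle-edges : All (λ p → InCycle d p × CyclicNeighbours d (proj₁ p) (proj₂ p)) (cycleEdges d)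
    cycle-nonEdges : All (λ p → InCycle d p × ¬ CyclicNeighbours d (proj₁ p) (proj₂ p)) (cycleNonEdges d)

cyclic? : ∀ d u v → Dec (CyclicNeighbours d u v)
cyclic? d u v = (suc u ℕₚ.≟ v) ⊎-dec ((suc v ℕₚ.≟ u) ⊎-dec
                (((suc u ℕₚ.≟ d) ×-dec (v ℕₚ.≟ 0)) ⊎-dec ((suc v ℕₚ.≟ d) ×-dec (u ℕₚ.≟ 0))))

cycleShape? : ∀ d → Dec (CycleShape d)
cycleShape? d = Dec.map′ (λ (e , ne) → record { cycle-edges = e ; cycle-nonEdges = ne })
                         (λ c → CycleShape.cycle-edges c , CycleShape.cycle-nonEdges c)
  (All.all? (λ (u , v) → inCycle? u v ×-dec cyclic? d u v) (cycleEdges d) ×-dec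
   All.all? (λ (u , v) → inCycle? u v ×-dec ¬? (cyclic? d u v)) (cycleNonEdges d))
  where
  inCycle? : ∀ u v → Dec (InCycle d (u , v))
  inCycle? u v = (u ℕₚ.<? d) ×-dec ((v ℕₚ.<? d) ×-dec ¬? (u ℕₚ.≟ v))

cycleShape : ∀ d → d ≡ 4 ⊎ d ≡ 5 → CycleShape d
cycleShape .4 (inj₁ refl) = from-yes (cycleShape? 4)
cycleShape .5 (inj₂ refl) = from-yes (cycleShape? 5)

listed-sound : ∀ {P : ℕ × ℕ → Set} x y ps → listed x y ps ≡ true → All P ps → P (x , y)
listed-sound x y ((a , b) ∷ ps) e (p ∷ ps-hold) with ∨-elim {(x ≡ᵇ a) ∧ (y ≡ᵇ b)} e
... | inj₂ later = listed-sound x y ps later ps-hold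
... | inj₁ here′ with ≡ᵇ-sound x a (∧-elimˡ here′) | ≡ᵇ-sound y b (∧-elimʳ {x ≡ᵇ a} here′)
...   | refl | refl = p

allB-sound : {X : Set} (p : X → Bool) → ∀ xs → allB p xs ≡ true → All (λ x → p x ≡ true) xs
allB-sound p [] _ = []
allB-sound p (x ∷ xs) e = ∧-elimˡ e ∷ allB-sound p xs (∧-elimʳ {p x} e)

allᶠ-sound : ∀ m p → allᶠ m p ≡ true → ∀ i → p i ≡ true
allᶠ-sound (suc m) p e Fin.zero = ∧-elimˡ e
allᶠ-sound (suc m) p e (Fin.suc i) = allᶠ-sound m (p ∘ Fin.suc) (∧-elimʳ {p Fin.zero} e) i

anyᶠ-sound : ∀ m p → anyᶠ m p ≡ true → Σ (Fin m) λ i → p i ≡ true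
anyᶠ-sound (suc m) p e with ∨-elim {p Fin.zero} e
... | inj₁ e₀ = Fin.zero , e₀
... | inj₂ e₁ = let i , pi = anyᶠ-sound m (p ∘ Fin.suc) e₁ in Fin.suc i , pi

lookupMaybe-sound : {X : Set} {P : X → Set} → ∀ xs t {x} → lookupMaybe xs t ≡ just x → All P xs → P x
lookupMaybe-sound (x ∷ xs) zero refl (p ∷ _) = p
lookupMaybe-sound (x ∷ xs) (suc t) e (_ ∷ ps) = lookupMaybe-sound xs t e ps

fresh-not-below : ∀ k t → (k + t <ᵇ k) ≡ false
fresh-not-below zero t = refl
fresh-not-below (suc zero) t = refl
fresh-not-below (suc (suc k)) t = fresh-not-below (suc k) t

-- Fix a connected 2-graph G of positive
-- curvature; knowledge holds under a naming of vertices if every recorded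
-- fact is true of the named vertices.  Every checking step preserves truth,
-- so a valid certificate for true knowledge classifies G.
module Soundness (G : Graph) (two : TwoGraph G) (pc : PositiveCurvature G)
                 (connected : ∀ u v → Reachable G u v) where
  open GraphFacts G
  open TwoGraphStructure G two

  Naming : Set
  Naming = ℕ → V

  PairHolds : (V → V → Set) → Naming → ℕ × ℕ → Set
  PairHolds R env p = R (env (proj₁ p)) (env (proj₂ p))

  EdgeHolds NonEdgeHolds UnequalHolds : Naming → ℕ × ℕ → Set
  EdgeHolds = PairHolds (λ u v → A u v ≡ true)
  NonEdgeHolds = PairHolds (λ u v → A u v ≡ false)
  UnequalHolds = PairHolds _≢_

  LinkHolds : Naming → ℕ × List ℕ → Set
  LinkHolds env (a , ws) = ∀ z → A (env a) z ≡ true → Any (λ u → env u ≡ z) ws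

  record Holds (env : Naming) (s : Knowledge) : Set where
    constructor holds
    field
      edgesHold : All (EdgeHolds env) (edges s)
      nonEdgesHold : All (NonEdgeHolds env) (nonEdges s)
      unequalHold : All (UnequalHolds env) (unequal s)
      linksHold : All (LinkHolds env) (links s)
  open Holds

  Classified : Set
  Classified = Σ (Fin 6) λ t → G ≅ deltahedron t

  module _ {env : Naming} {s : Knowledge} (h : Holds env s) where

    knownEdge-sound : ∀ x y → knownEdge s x y ≡ true → A (env x) (env y) ≡ true
    knownEdge-sound x y e with ∨-elim {listed x y (edges s)} e
    ... | inj₁ e₁ = listed-sound {EdgeHolds env} x y (edges s) e₁ (edgesHold h)
    ... | inj₂ e₂ = adj-sym (listed-sound {EdgeHolds env} y x (edges s) e₂ (edgesHold h))

    knownNonEdge-sound : ∀ x y → knownNonEdge s x y ≡ true → A (env x) (env y) ≡ false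
    knownNonEdge-sound x y e with ∨-elim {listed x y (nonEdges s)} e
    ... | inj₁ e₁ = listed-sound {NonEdgeHolds env} x y (nonEdges s) e₁ (nonEdgesHold h)
    ... | inj₂ e₂ = trans (Graph.sym G (env x) (env y))
                          (listed-sound {NonEdgeHolds env} y x (nonEdges s) e₂ (nonEdgesHold h))

    knownEdges-sound : ∀ ps → knownEdges s ps ≡ true → All (EdgeHolds env) ps
    knownEdges-sound ps e = All.map (λ {p} → knownEdge-sound (proj₁ p) (proj₂ p)) (allB-sound _ ps e)

    apart-sound : ∀ x y ev → apart? s x y ev ≡ true → env x ≢ env y
    apart-sound x y byEdge e = adj⇒≢ (knownEdge-sound x y e)
    apart-sound x y recorded e with ∨-elim {listed x y (unequal s)} e
    ... | inj₁ e₁ = listed-sound {UnequalHolds env} x y (unequal s) e₁ (unequalHold h)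
    ... | inj₂ e₂ = listed-sound {UnequalHolds env} y x (unequal s) e₂ (unequalHold h) ∘ ≡.sym
    apart-sound x y (separatedBy z) e =
      separated (knownEdge-sound x z (∧-elimˡ e)) (knownNonEdge-sound y z (∧-elimʳ {knownEdge s x z} e))
    apart-sound x y (separatedBy′ z) e =
      separated (knownEdge-sound y z (∧-elimʳ {knownNonEdge s x z} e)) (knownNonEdge-sound x z (∧-elimˡ e)) ∘ ≡.sym

    apartAll-sound : ∀ x ws evs → apartAll? s x ws evs ≡ true → All (λ u → env x ≢ env u) ws
    apartAll-sound x [] [] e = []
    apartAll-sound x (w ∷ ws) (ev ∷ evs) e =
      apart-sound x w ev (∧-elimˡ e) ∷ apartAll-sound x ws evs (∧-elimʳ {apart? s x w ev} e)

    -- the common neighbours of an edge are determined, so x and y coincide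
    identify-sound : ∀ a b c x y ex ey → identify-ok s a b c x y ex ey ≡ true → env x ≡ env y
    identify-sound a b c x y ex ey e
      with ab ∷ ac ∷ bc ∷ ax ∷ bx ∷ ay ∷ by ∷ [] ← knownEdges-sound (identifyEdges a b c x y) (∧-elimˡ e)
         | x-apart , y-apart ← ∧-split (apart? s x c ex) (∧-elimʳ {knownEdges s (identifyEdges a b c x y)} e)
      = third-common-unique ab ac bc ax bx ay by (apart-sound x c ex x-apart) (apart-sound y c ey y-apart)

    -- x is apart from every neighbour of a, so it is not one of them
    nonAdjacent-sound : ∀ a x l evs → nonAdjacent-ok s a x l evs ≡ true → A (env a) (env x) ≡ false
    nonAdjacent-sound a x l evs e with linkAt s l in found
    ... | just (a′ , ws) with A (env a) (env x) in ax
    ...   | false = refl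
    ...   | true = let x≢u , u≡x = All.lookupAny (apartAll-sound x ws evs (∧-elimʳ {a ≡ᵇ a′} e)) named-x
                   in contradiction (≡.sym u≡x) x≢u
      where
      named-x : Any (λ u → env u ≡ env x) ws
      named-x = lookupMaybe-sound {P = LinkHolds env} (links s) l found (linksHold h) (env x)
                  (subst (λ v → A (env v) (env x) ≡ true) (≡ᵇ-sound a a′ (∧-elimˡ e)) ax)

  rename-sound : ∀ {env s} y x → env x ≡ env y → Holds env s → Holds env (renameKnowledge y x s)
  rename-sound {env} {s} y x x≡y h = holds
    (renamed {λ u v → A u v ≡ true} (edgesHold h)) (renamed {λ u v → A u v ≡ false} (nonEdgesHold h))
    (renamed {_≢_} (unequalHold h))
    (Allₚ.map⁺ (All.map (λ {l} → renamedLink l) (linksHold h)))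
    where
    same : ∀ t → env (rename y x t) ≡ env t
    same t with t ≡ᵇ y in t≡y
    ... | true = trans x≡y (cong env (≡.sym (≡ᵇ-sound t y t≡y)))
    ... | false = refl
    renamed : ∀ {R ps} → All (PairHolds R env) ps → All (PairHolds R env) (List.map (renamePair y x) ps)
    renamed {R} = Allₚ.map⁺ ∘ All.map (λ {p} → subst₂ R (≡.sym (same (proj₁ p))) (≡.sym (same (proj₂ p))))
    renamedLink : ∀ l → LinkHolds env l → LinkHolds env (rename y x (proj₁ l) , List.map (rename y x) (proj₂ l))
    renamedLink (a , ws) link z az =
      Anyₚ.map⁺ (Any.map (λ {u} eu → trans (same u) eu) (link z (trans (cong (λ v → A v z) (≡.sym (same a))) az)))

  addNonEdge-sound : ∀ {env s} a x → A (env a) (env x) ≡ false → Holds env s → Holds env (addNonEdge a x s)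
  addNonEdge-sound a x ax h = holds (edgesHold h) (ax ∷ nonEdgesHold h) (unequalHold h) (linksHold h)

  reinterpret : ∀ {env env′ s} K → (∀ t → (t <ᵇ K) ≡ true → env′ t ≡ env t)
    → namesBelow K s ≡ true → Holds env s → Holds env′ s
  reinterpret {env} {env′} {s} K agrees below h =
    let eb , rest₁ = ∧-split (allB (pairBelow K) (edges s)) below
        nb , rest₂ = ∧-split (allB (pairBelow K) (nonEdges s)) rest₁
        ub , lb = ∧-split (allB (pairBelow K) (unequal s)) rest₂
    in holds (moved {λ u v → A u v ≡ true} (edgesHold h) eb) (moved {λ u v → A u v ≡ false} (nonEdgesHold h) nb)
             (moved {_≢_} (unequalHold h) ub)
             (All.zipWith (λ {l} (q , b) → relink l q b) (linksHold h , allB-sound (linkBelow K) (links s) lb))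
    where
    moved : ∀ {R ps} → All (PairHolds R env) ps → allB (pairBelow K) ps ≡ true → All (PairHolds R env′) ps
    moved {R} {ps} hs bs = All.zipWith (λ {p} (q , b) → shift p q b) (hs , allB-sound (pairBelow K) ps bs)
      where
      shift : ∀ p → PairHolds R env p → pairBelow K p ≡ true → PairHolds R env′ p
      shift (x , y) q b = let x<K , y<K = ∧-split (x <ᵇ K) b
                          in subst₂ R (≡.sym (agrees x x<K)) (≡.sym (agrees y y<K)) q
    relink : ∀ l → LinkHolds env l → linkBelow K l ≡ true → LinkHolds env′ l
    relink (x , ws) q b z e =
      let x<K , ws<K = ∧-split (x <ᵇ K) b
      in any-within (λ {u} eu u<K → trans (agrees u u<K) eu)
                    (q z (trans (cong (λ v → A v z) (≡.sym (agrees x x<K))) e)) (allB-sound (_<ᵇ K) ws ws<K)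

  -- Opening the link of a along the triangle a i j: the walk around S(a)
  -- interprets the fresh names.
  module OpenLinkSound {env : Naming} {s : Knowledge} (h : Holds env s) (a i j : ℕ)
    (pre : openLink-ok s a i j ≡ true) where

    K : ℕ
    K = named s

    triangle-known : knownEdges s ((a , i) ∷ (a , j) ∷ (i , j) ∷ []) ≡ true
    triangle-known = proj₁ (∧-split (knownEdges s ((a , i) ∷ (a , j) ∷ (i , j) ∷ [])) pre)

    below : namesBelow K s ≡ true
    below = proj₂ (∧-split (knownEdges s ((a , i) ∷ (a , j) ∷ (i , j) ∷ [])) pre)

    triangle : All (EdgeHolds env) ((a , i) ∷ (a , j) ∷ (i , j) ∷ [])
    triangle = knownEdges-sound h _ triangle-known

    module W = Walk (env a) (env i) (env j) (All.head triangle) (All.head (All.tail triangle))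
                    (All.head (All.tail (All.tail triangle)))
    cycle : W.ShortCycle
    cycle = W.short-cycle pc
    open W.ShortCycle cycle

    env′ : Naming
    env′ t = if t <ᵇ K then env t else W.walk (suc (suc (t ∸ K)))

    agrees : ∀ t → (t <ᵇ K) ≡ true → env′ t ≡ env t
    agrees t t<K rewrite t<K = refl

    edgesBelow : All (λ p → pairBelow K p ≡ true) (edges s)
    edgesBelow = allB-sound (pairBelow K) (edges s) (∧-elimˡ below)

    edge-below : ∀ x y → knownEdge s x y ≡ true → (x <ᵇ K) ≡ true × (y <ᵇ K) ≡ true
    edge-below x y e with ∨-elim {listed x y (edges s)} e
    ... | inj₁ e₁ = ∧-split (x <ᵇ K) (listed-sound {λ p → pairBelow K p ≡ true} x y (edges s) e₁ edgesBelow)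
    ... | inj₂ e₂ = let y<K , x<K = ∧-split (y <ᵇ K) (listed-sound {λ p → pairBelow K p ≡ true} y x (edges s) e₂ edgesBelow)
                    in x<K , y<K


    env′-a : env′ a ≡ env a
    env′-a = agrees a (proj₁ (edge-below a i (∧-elimˡ triangle-known)))

    env′-name : ∀ u → env′ (linkName i j K u) ≡ W.walk u
    env′-name zero = agrees i (proj₂ (edge-below a i (∧-elimˡ triangle-known)))
    env′-name (suc zero) = agrees j (proj₂ (edge-below a j (∧-elimˡ (∧-elimʳ {knownEdge s a i} triangle-known))))
    env′-name (suc (suc t)) rewrite fresh-not-below K t = cong (λ m → W.walk (suc (suc m))) (ℕₚ.m+n∸m≡n K t)

    shape : CycleShape length
    shape = cycleShape length length-4-or-5
    open CycleShape shape

    named-rim : ∀ {R} (p : ℕ × ℕ) → R (W.walk (proj₁ p)) (W.walk (proj₂ p)) → PairHolds R env′ (linkNamePair i j K p)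
    named-rim {R} (u , v) = subst₂ R (≡.sym (env′-name u)) (≡.sym (env′-name v))

    spoke : ∀ u → EdgeHolds env′ (a , linkName i j K u)
    spoke u = subst₂ (λ x y → A x y ≡ true) (≡.sym env′-a) (≡.sym (env′-name u)) (W.in-link u)

    rim-edge : ∀ {p} → InCycle length p × CyclicNeighbours length (proj₁ p) (proj₂ p) → EdgeHolds env′ (linkNamePair i j K p)
    rim-edge {p} (_ , c) = named-rim {λ x y → A x y ≡ true} p (cyclic⇒rim _ _ c)

    rim-nonEdge : ∀ {p} → InCycle length p × ¬ CyclicNeighbours length (proj₁ p) (proj₂ p)
      → NonEdgeHolds env′ (linkNamePair i j K p)
    rim-nonEdge {p@(u , v)} ((u< , v< , _) , ¬c) = named-rim {λ x y → A x y ≡ false} p nonEdge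
      where
      nonEdge : A (W.walk u) (W.walk v) ≡ false
      nonEdge with A (W.walk u) (W.walk v) in uv
      ... | false = refl
      ... | true = contradiction (rim⇒cyclic u v u< v< uv) ¬c

    rim-unequal : ∀ {p} → InCycle length p → UnequalHolds env′ (linkNamePair i j K p)
    rim-unequal {p@(u , v)} (u< , v< , u≢v) = named-rim {_≢_} p (u≢v ∘ walk-injective u v u< v<)

    link : LinkHolds env′ (a , List.map (linkName i j K) (List.upTo length))
    link z az = let u , u< , walk-u = covers z (trans (cong (λ x → A x z) (≡.sym env′-a)) az)
                in Anyₚ.map⁺ (Any.map (λ {w} u≡w → trans (env′-name w) (trans (cong W.walk (≡.sym u≡w)) walk-u))
                                      (∈-upTo⁺ u<))

    opened : Holds env′ (openLinkOf length s a i j)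
    opened = holds
      (Allₚ.++⁺ (Allₚ.map⁺ (All.universal spoke (List.upTo length)))
        (Allₚ.++⁺ (Allₚ.map⁺ (All.map rim-edge cycle-edges)) (edgesHold old)))
      (Allₚ.++⁺ (Allₚ.map⁺ (All.map rim-nonEdge cycle-nonEdges)) (nonEdgesHold old))
      (Allₚ.++⁺ (Allₚ.map⁺ (All.map (rim-unequal ∘ proj₁) cycle-edges))
        (Allₚ.++⁺ (Allₚ.map⁺ (All.map (rim-unequal ∘ proj₁) cycle-nonEdges)) (unequalHold old)))
      (link ∷ linksHold old)
      where
      old : Holds env′ s
      old = reinterpret K agrees below h

  match-sound : ∀ {env s} → Holds env s → ∀ t σ lks ev → Match.matches s t σ lks ev ≡ true → Classified
  match-sound {env} {s} h t σ lks ev ok =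
    t , local-isomorphism⇒≅ G H φ preserves (λ v → onto v (allᶠ-sound N linkCovered linksOk v)) injective
                             v₀ connected
    where
    open Match s t σ lks ev
    edgesOk : edgesKnown ≡ true
    edgesOk = proj₁ (∧-split edgesKnown ok)
    linksOk : allᶠ N linkCovered ≡ true
    linksOk = proj₁ (∧-split (allᶠ N linkCovered) (proj₂ (∧-split edgesKnown ok)))
    apartOk : namesApart ≡ true
    apartOk = proj₂ (∧-split (allᶠ N linkCovered) (proj₂ (∧-split edgesKnown ok)))

    φ : Fin N → V
    φ v = env σ[ v ]

    preserves : ∀ v w → adj H v w ≡ true → A (φ v) (φ w) ≡ true
    preserves v w e = knownEdge-sound h σ[ v ] σ[ w ]
      (subst (λ b → not b ∨ knownEdge s σ[ v ] σ[ w ] ≡ true) e (allᶠ-sound N _ (allᶠ-sound N _ edgesOk v) w))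

    onto : ∀ v → linkCovered v ≡ true → ∀ y → A (φ v) y ≡ true → Σ (Fin N) λ w → adj H v w ≡ true × φ w ≡ y
    onto v covered y vy with linkAt s (lookupOr lks (toℕ v) 0) in found
    ... | just (a′ , ws) =
      let σv≡a′ , wsOk = ∧-split (σ[ v ] ≡ᵇ a′) covered
          named-y = lookupMaybe-sound {P = LinkHolds env} (links s) _ found (linksHold h) y
                      (subst (λ x → A (env x) y ≡ true) (≡ᵇ-sound σ[ v ] a′ σv≡a′) vy)
          u , u-names-y , u-covered = Any.satisfied (any-within _,_ named-y (allB-sound _ ws wsOk))
          w , vw-σw≡u = anyᶠ-sound N _ u-covered
          vw , σw≡u = ∧-split (adj H v w) vw-σw≡u
      in w , vw , trans (cong env (≡ᵇ-sound σ[ w ] _ σw≡u)) u-names-y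

    injective : ∀ v w → φ v ≡ φ w → v ≡ w
    injective v w e with ∨-elim {toℕ v ≡ᵇ toℕ w} (allᶠ-sound N _ (allᶠ-sound N _ apartOk v) w)
    ... | inj₁ same = toℕ-injective (≡ᵇ-sound (toℕ v) (toℕ w) same)
    ... | inj₂ apart = contradiction e (apart-sound h σ[ v ] σ[ w ] (apartness v w) apart)

    v₀ : Fin N
    v₀ = fromℕ< (proj₁ (proj₁ (deltahedron-properties t)))

  -- every step preserves truth, and no branch of a valid certificate is
  -- left open: the contradictory ones cannot occur
  sound : ∀ c {env s} → Holds env s → valid s c ≡ true → Classified
  sound (identify a b c x y ex ey ▸ rest) {s = s} h e =
    let ok , e′ = ∧-split (identify-ok s a b c x y ex ey) e
    in sound rest (rename-sound y x (identify-sound h a b c x y ex ey ok) h) e′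
  sound (nonAdjacent a x l evs ▸ rest) {s = s} h e =
    let ok , e′ = ∧-split (nonAdjacent-ok s a x l evs) e
    in sound rest (addNonEdge-sound a x (nonAdjacent-sound h a x l evs ok) h) e′
  sound (openLink a i j c₄ c₅) {s = s} h e = branch length-4-or-5
    where
    pre : openLink-ok s a i j ≡ true
    pre = proj₁ (∧-split (openLink-ok s a i j) e)
    subtrees : (valid (openLinkOf 4 s a i j) c₄ ∧ valid (openLinkOf 5 s a i j) c₅) ≡ true
    subtrees = proj₂ (∧-split (openLink-ok s a i j) e)
    open OpenLinkSound h a i j pre
    open W.ShortCycle cycle using (length; length-4-or-5)
    branch : length ≡ 4 ⊎ length ≡ 5 → Classified
    branch (inj₁ four) = sound c₄ (subst (λ d → Holds env′ (openLinkOf d s a i j)) four opened) (∧-elimˡ subtrees)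
    branch (inj₂ five) = sound c₅ (subst (λ d → Holds env′ (openLinkOf d s a i j)) five opened)
                               (∧-elimʳ {valid (openLinkOf 4 s a i j) c₄} subtrees)
  sound (clash x y) {s = s} h e =
    let xy , ¬xy = ∧-split (knownEdge s x y) e
    in contradiction (trans (≡.sym (knownEdge-sound h x y xy)) (knownNonEdge-sound h x y ¬xy)) true≢false
  sound (match t σ lks ev) h e = match-sound h t σ lks ev e

-- The classification certificate: a case tree of 126 link openings, found by
-- a computer search and checked here by evaluation.

certificate : Certificate
certificate =
  openLink 0 1 2
    (openLink 1 0 2
       (identify 1 0 2 4 6 recorded recorded ▸
        openLink 2 0 1
          (identify 2 0 1 3 8 recorded recorded ▸
           identify 2 1 0 5 7 recorded recorded ▸
           openLink 3 0 2
             (identify 3 0 2 4 10 recorded recorded ▸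
              identify 3 2 0 5 9 recorded recorded ▸
              openLink 4 0 1
                (identify 4 0 1 3 12 recorded recorded ▸
                 identify 4 1 0 5 11 recorded recorded ▸
                 openLink 5 1 2
                   (identify 5 1 2 4 14 recorded recorded ▸
                    identify 5 2 1 3 13 recorded recorded ▸
                    match (# 0)
                      (0 ∷ 5 ∷ 1 ∷ 2 ∷ 3 ∷ 4 ∷ [])
                      (5 ∷ 0 ∷ 4 ∷ 3 ∷ 2 ∷ 1 ∷ [])
                      ((byEdge ∷ recorded ∷ byEdge ∷ byEdge ∷ byEdge ∷ byEdge ∷ []) ∷
                       (recorded ∷ byEdge ∷ byEdge ∷ byEdge ∷ byEdge ∷ byEdge ∷ []) ∷
                       (byEdge ∷ byEdge ∷ byEdge ∷ byEdge ∷ recorded ∷ byEdge ∷ []) ∷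
                       (byEdge ∷ byEdge ∷ byEdge ∷ byEdge ∷ byEdge ∷ recorded ∷ []) ∷
                       (byEdge ∷ byEdge ∷ recorded ∷ byEdge ∷ byEdge ∷ byEdge ∷ []) ∷
                       (byEdge ∷ byEdge ∷ byEdge ∷ recorded ∷ byEdge ∷ byEdge ∷ []) ∷
                       []))
                   (identify 5 1 2 4 15 recorded recorded ▸
                    identify 5 2 1 3 13 recorded recorded ▸
                    clash 3 4))
                (identify 4 0 1 3 13 recorded recorded ▸
                 identify 4 1 0 5 11 recorded recorded ▸
                 clash 5 3))
             (identify 3 0 2 4 11 recorded recorded ▸
              identify 3 2 0 5 9 recorded recorded ▸
              clash 5 4))
          (identify 2 0 1 3 9 recorded recorded ▸
           identify 2 1 0 5 7 recorded recorded ▸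
           openLink 3 0 2
             (identify 3 0 2 4 11 recorded recorded ▸
              identify 3 2 0 8 10 recorded recorded ▸
              openLink 4 0 1
                (identify 4 0 1 3 13 recorded recorded ▸
                 identify 4 1 0 5 12 recorded recorded ▸
                 clash 5 3)
                (identify 4 0 1 3 14 recorded recorded ▸
                 identify 4 1 0 5 12 recorded recorded ▸
                 identify 4 5 1 8 13 recorded recorded ▸
                 openLink 5 1 2
                   (identify 5 1 2 4 16 recorded recorded ▸
                    identify 5 2 1 8 15 recorded recorded ▸
                    openLink 8 2 3
                      (identify 8 2 3 5 18 recorded recorded ▸
                       identify 8 3 2 4 17 recorded recorded ▸
                       match (# 1)
                         (2 ∷ 4 ∷ 0 ∷ 1 ∷ 5 ∷ 8 ∷ 3 ∷ [])
                         (4 ∷ 2 ∷ 6 ∷ 5 ∷ 1 ∷ 0 ∷ 3 ∷ [])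
                         ((byEdge ∷ recorded ∷ byEdge ∷ byEdge ∷ byEdge ∷ byEdge ∷ byEdge ∷ []) ∷
                          (recorded ∷ byEdge ∷ byEdge ∷ byEdge ∷ byEdge ∷ byEdge ∷ byEdge ∷ []) ∷
                          (byEdge ∷ byEdge ∷ byEdge ∷ byEdge ∷ recorded ∷ recorded ∷ byEdge ∷ []) ∷
                          (byEdge ∷ byEdge ∷ byEdge ∷ byEdge ∷ byEdge ∷ recorded ∷ recorded ∷ []) ∷
                          (byEdge ∷ byEdge ∷ recorded ∷ byEdge ∷ byEdge ∷ byEdge ∷ recorded ∷ []) ∷
                          (byEdge ∷ byEdge ∷ recorded ∷ recorded ∷ byEdge ∷ byEdge ∷ byEdge ∷ []) ∷
                          (byEdge ∷ byEdge ∷ byEdge ∷ recorded ∷ recorded ∷ byEdge ∷ byEdge ∷ []) ∷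
                          []))
                      (identify 8 2 3 5 19 recorded recorded ▸
                       identify 8 3 2 4 17 recorded recorded ▸
                       clash 5 4))
                   (identify 5 1 2 4 17 recorded recorded ▸
                    identify 5 2 1 8 15 recorded recorded ▸
                    clash 4 8)))
             (identify 3 0 2 4 12 recorded recorded ▸
              identify 3 2 0 8 10 recorded recorded ▸
              nonAdjacent 1 11 2 (recorded ∷ recorded ∷ (separatedBy 3) ∷ byEdge ∷ []) ▸
              openLink 4 0 1
                (identify 4 0 1 3 14 recorded recorded ▸
                 identify 4 1 0 5 13 recorded recorded ▸
                 clash 5 3)
                (identify 4 0 1 3 15 recorded recorded ▸
                 identify 4 1 0 5 13 recorded recorded ▸
                 identify 4 3 0 11 14 recorded recorded ▸
                 openLink 5 1 2
                   (identify 5 1 2 4 17 recorded recorded ▸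
                    identify 5 2 1 8 16 recorded recorded ▸
                    clash 4 8)
                   (identify 5 1 2 4 18 recorded recorded ▸
                    identify 5 2 1 8 16 recorded recorded ▸
                    identify 5 8 2 11 17 recorded recorded ▸
                    openLink 8 2 3
                      (identify 8 2 3 5 20 recorded recorded ▸
                       identify 8 3 2 11 19 recorded recorded ▸
                       openLink 11 3 4
                         (identify 11 3 4 8 22 recorded recorded ▸
                          identify 11 4 3 5 21 recorded recorded ▸
                          match (# 2)
                            (0 ∷ 1 ∷ 2 ∷ 3 ∷ 4 ∷ 5 ∷ 8 ∷ 11 ∷ [])
                            (7 ∷ 6 ∷ 5 ∷ 4 ∷ 3 ∷ 2 ∷ 1 ∷ 0 ∷ [])
                            ((byEdge ∷ byEdge ∷ byEdge ∷ byEdge ∷ byEdge ∷ recorded ∷ recorded ∷ recorded ∷ []) ∷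
                             (byEdge ∷ byEdge ∷ byEdge ∷ recorded ∷ byEdge ∷ byEdge ∷ recorded ∷ recorded ∷ []) ∷
                             (byEdge ∷ byEdge ∷ byEdge ∷ byEdge ∷ recorded ∷ byEdge ∷ byEdge ∷ recorded ∷ []) ∷
                             (byEdge ∷ recorded ∷ byEdge ∷ byEdge ∷ byEdge ∷ recorded ∷ byEdge ∷ byEdge ∷ []) ∷
                             (byEdge ∷ byEdge ∷ recorded ∷ byEdge ∷ byEdge ∷ byEdge ∷ recorded ∷ byEdge ∷ []) ∷
                             (recorded ∷ byEdge ∷ byEdge ∷ recorded ∷ byEdge ∷ byEdge ∷ byEdge ∷ byEdge ∷ []) ∷
                             (recorded ∷ recorded ∷ byEdge ∷ byEdge ∷ recorded ∷ byEdge ∷ byEdge ∷ byEdge ∷ []) ∷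
                             (recorded ∷ recorded ∷ recorded ∷ byEdge ∷ byEdge ∷ byEdge ∷ byEdge ∷ byEdge ∷ []) ∷
                             []))
                         (identify 11 3 4 8 23 recorded recorded ▸
                          identify 11 4 3 5 21 recorded recorded ▸
                          clash 8 5))
                      (identify 8 2 3 5 21 recorded recorded ▸
                       identify 8 3 2 11 19 recorded recorded ▸
                       clash 11 5))))))
       (identify 1 0 2 4 7 recorded recorded ▸
        openLink 2 0 1
          (identify 2 0 1 3 9 recorded recorded ▸
           identify 2 1 0 5 8 recorded recorded ▸
           openLink 3 0 2
             (identify 3 0 2 4 11 recorded recorded ▸
              identify 3 2 0 5 10 recorded recorded ▸
              clash 5 4)
             (identify 3 0 2 4 12 recorded recorded ▸
              identify 3 2 0 5 10 recorded recorded ▸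
              openLink 4 0 1
                (identify 4 0 1 3 14 recorded recorded ▸
                 identify 4 1 0 6 13 recorded recorded ▸
                 identify 4 3 0 6 11 recorded recorded ▸
                 openLink 5 1 2
                   (identify 5 1 2 6 16 recorded recorded ▸
                    identify 5 2 1 3 15 recorded recorded ▸
                    openLink 6 1 4
                      (identify 6 1 4 5 18 recorded recorded ▸
                       identify 6 4 1 3 17 recorded recorded ▸
                       match (# 1)
                         (1 ∷ 3 ∷ 0 ∷ 2 ∷ 5 ∷ 6 ∷ 4 ∷ [])
                         (5 ∷ 3 ∷ 6 ∷ 4 ∷ 1 ∷ 0 ∷ 2 ∷ [])
                         ((byEdge ∷ recorded ∷ byEdge ∷ byEdge ∷ byEdge ∷ byEdge ∷ byEdge ∷ []) ∷
                          (recorded ∷ byEdge ∷ byEdge ∷ byEdge ∷ byEdge ∷ byEdge ∷ byEdge ∷ []) ∷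
                          (byEdge ∷ byEdge ∷ byEdge ∷ byEdge ∷ recorded ∷ recorded ∷ byEdge ∷ []) ∷
                          (byEdge ∷ byEdge ∷ byEdge ∷ byEdge ∷ byEdge ∷ recorded ∷ recorded ∷ []) ∷
                          (byEdge ∷ byEdge ∷ recorded ∷ byEdge ∷ byEdge ∷ byEdge ∷ recorded ∷ []) ∷
                          (byEdge ∷ byEdge ∷ recorded ∷ recorded ∷ byEdge ∷ byEdge ∷ byEdge ∷ []) ∷
                          (byEdge ∷ byEdge ∷ byEdge ∷ recorded ∷ recorded ∷ byEdge ∷ byEdge ∷ []) ∷
                          []))
                      (identify 6 1 4 5 19 recorded recorded ▸
                       identify 6 4 1 3 17 recorded recorded ▸
                       clash 5 3))
                   (identify 5 1 2 6 17 recorded recorded ▸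
                    identify 5 2 1 3 15 recorded recorded ▸
                    clash 3 6))
                (identify 4 0 1 3 15 recorded recorded ▸
                 identify 4 1 0 6 13 recorded recorded ▸
                 identify 4 3 0 11 14 recorded recorded ▸
                 openLink 5 1 2
                   (identify 5 1 2 6 17 recorded recorded ▸
                    identify 5 2 1 3 16 recorded recorded ▸
                    clash 3 6)
                   (identify 5 1 2 6 18 recorded recorded ▸
                    identify 5 2 1 3 16 recorded recorded ▸
                    identify 5 3 2 11 17 recorded recorded ▸
                    openLink 6 1 4
                      (identify 6 1 4 5 20 recorded recorded ▸
                       identify 6 4 1 11 19 recorded recorded ▸
                       openLink 11 3 4
                         (identify 11 3 4 5 22 recorded recorded ▸
                          identify 11 4 3 6 21 recorded recorded ▸
                          match (# 2)
                            (0 ∷ 2 ∷ 1 ∷ 4 ∷ 3 ∷ 5 ∷ 6 ∷ 11 ∷ [])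
                            (7 ∷ 5 ∷ 6 ∷ 3 ∷ 4 ∷ 2 ∷ 1 ∷ 0 ∷ [])
                            ((byEdge ∷ byEdge ∷ byEdge ∷ byEdge ∷ byEdge ∷ recorded ∷ recorded ∷ recorded ∷ []) ∷
                             (byEdge ∷ byEdge ∷ byEdge ∷ recorded ∷ byEdge ∷ byEdge ∷ recorded ∷ recorded ∷ []) ∷
                             (byEdge ∷ byEdge ∷ byEdge ∷ byEdge ∷ recorded ∷ byEdge ∷ byEdge ∷ recorded ∷ []) ∷
                             (byEdge ∷ recorded ∷ byEdge ∷ byEdge ∷ byEdge ∷ recorded ∷ byEdge ∷ byEdge ∷ []) ∷
                             (byEdge ∷ byEdge ∷ recorded ∷ byEdge ∷ byEdge ∷ byEdge ∷ recorded ∷ byEdge ∷ []) ∷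
                             (recorded ∷ byEdge ∷ byEdge ∷ recorded ∷ byEdge ∷ byEdge ∷ byEdge ∷ byEdge ∷ []) ∷
                             (recorded ∷ recorded ∷ byEdge ∷ byEdge ∷ recorded ∷ byEdge ∷ byEdge ∷ byEdge ∷ []) ∷
                             (recorded ∷ recorded ∷ recorded ∷ byEdge ∷ byEdge ∷ byEdge ∷ byEdge ∷ byEdge ∷ []) ∷
                             []))
                         (identify 11 3 4 5 23 recorded recorded ▸
                          identify 11 4 3 6 21 recorded recorded ▸
                          clash 5 6))
                      (identify 6 1 4 5 21 recorded recorded ▸
                       identify 6 4 1 11 19 recorded recorded ▸
                       clash 11 5)))))
          (identify 2 0 1 3 10 recorded recorded ▸
           identify 2 1 0 5 8 recorded recorded ▸
           openLink 3 0 2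
             (identify 3 0 2 4 12 recorded recorded ▸
              identify 3 2 0 9 11 recorded recorded ▸
              nonAdjacent 3 6 0 (recorded ∷ recorded ∷ (separatedBy 1) ∷ byEdge ∷ []) ▸
              openLink 4 0 1
                (identify 4 0 1 3 14 recorded recorded ▸
                 identify 4 1 0 6 13 recorded recorded ▸
                 clash 3 6)
                (identify 4 0 1 3 15 recorded recorded ▸
                 identify 4 1 0 6 13 recorded recorded ▸
                 identify 4 3 0 9 14 recorded recorded ▸
                 openLink 9 2 3
                   (identify 9 2 3 5 17 recorded recorded ▸
                    identify 9 3 2 4 16 recorded recorded ▸
                    clash 5 4)
                   (identify 9 2 3 5 18 recorded recorded ▸
                    identify 9 3 2 4 16 recorded recorded ▸
                    identify 9 4 3 6 17 recorded recorded ▸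
                    openLink 5 1 2
                      (identify 5 1 2 6 20 recorded recorded ▸
                       identify 5 2 1 9 19 recorded recorded ▸
                       openLink 6 1 4
                         (identify 6 1 4 5 22 recorded recorded ▸
                          identify 6 4 1 9 21 recorded recorded ▸
                          match (# 2)
                            (0 ∷ 3 ∷ 2 ∷ 1 ∷ 4 ∷ 9 ∷ 5 ∷ 6 ∷ [])
                            (7 ∷ 4 ∷ 5 ∷ 6 ∷ 3 ∷ 2 ∷ 1 ∷ 0 ∷ [])
                            ((byEdge ∷ byEdge ∷ byEdge ∷ byEdge ∷ byEdge ∷ recorded ∷ recorded ∷ recorded ∷ []) ∷
                             (byEdge ∷ byEdge ∷ byEdge ∷ recorded ∷ byEdge ∷ byEdge ∷ recorded ∷ recorded ∷ []) ∷
                             (byEdge ∷ byEdge ∷ byEdge ∷ byEdge ∷ recorded ∷ byEdge ∷ byEdge ∷ recorded ∷ []) ∷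
                             (byEdge ∷ recorded ∷ byEdge ∷ byEdge ∷ byEdge ∷ recorded ∷ byEdge ∷ byEdge ∷ []) ∷
                             (byEdge ∷ byEdge ∷ recorded ∷ byEdge ∷ byEdge ∷ byEdge ∷ recorded ∷ byEdge ∷ []) ∷
                             (recorded ∷ byEdge ∷ byEdge ∷ recorded ∷ byEdge ∷ byEdge ∷ byEdge ∷ byEdge ∷ []) ∷
                             (recorded ∷ recorded ∷ byEdge ∷ byEdge ∷ recorded ∷ byEdge ∷ byEdge ∷ byEdge ∷ []) ∷
                             (recorded ∷ recorded ∷ recorded ∷ byEdge ∷ byEdge ∷ byEdge ∷ byEdge ∷ byEdge ∷ []) ∷
                             []))
                         (identify 6 1 4 5 23 recorded recorded ▸
                          identify 6 4 1 9 21 recorded recorded ▸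
                          clash 9 5))
                      (identify 5 1 2 6 21 recorded recorded ▸
                       identify 5 2 1 9 19 recorded recorded ▸
                       clash 9 6))))
             (identify 3 0 2 4 13 recorded recorded ▸
              identify 3 2 0 9 11 recorded recorded ▸
              openLink 4 0 1
                (identify 4 0 1 3 15 recorded recorded ▸
                 identify 4 1 0 6 14 recorded recorded ▸
                 identify 4 3 0 6 12 recorded recorded ▸
                 openLink 6 1 4
                   (identify 6 1 4 5 17 recorded recorded ▸
                    identify 6 4 1 3 16 recorded recorded ▸
                    clash 5 3)
                   (identify 6 1 4 5 18 recorded recorded ▸
                    identify 6 4 1 3 16 recorded recorded ▸
                    identify 6 3 4 9 17 recorded recorded ▸
                    openLink 5 1 2
                      (identify 5 1 2 6 20 recorded recorded ▸
                       identify 5 2 1 9 19 recorded recorded ▸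
                       openLink 9 2 3
                         (identify 9 2 3 5 22 recorded recorded ▸
                          identify 9 3 2 6 21 recorded recorded ▸
                          match (# 2)
                            (0 ∷ 4 ∷ 1 ∷ 2 ∷ 3 ∷ 6 ∷ 5 ∷ 9 ∷ [])
                            (7 ∷ 3 ∷ 6 ∷ 5 ∷ 4 ∷ 2 ∷ 1 ∷ 0 ∷ [])
                            ((byEdge ∷ byEdge ∷ byEdge ∷ byEdge ∷ byEdge ∷ recorded ∷ recorded ∷ recorded ∷ []) ∷
                             (byEdge ∷ byEdge ∷ byEdge ∷ recorded ∷ byEdge ∷ byEdge ∷ recorded ∷ recorded ∷ []) ∷
                             (byEdge ∷ byEdge ∷ byEdge ∷ byEdge ∷ recorded ∷ byEdge ∷ byEdge ∷ recorded ∷ []) ∷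
                             (byEdge ∷ recorded ∷ byEdge ∷ byEdge ∷ byEdge ∷ recorded ∷ byEdge ∷ byEdge ∷ []) ∷
                             (byEdge ∷ byEdge ∷ recorded ∷ byEdge ∷ byEdge ∷ byEdge ∷ recorded ∷ byEdge ∷ []) ∷
                             (recorded ∷ byEdge ∷ byEdge ∷ recorded ∷ byEdge ∷ byEdge ∷ byEdge ∷ byEdge ∷ []) ∷
                             (recorded ∷ recorded ∷ byEdge ∷ byEdge ∷ recorded ∷ byEdge ∷ byEdge ∷ byEdge ∷ []) ∷
                             (recorded ∷ recorded ∷ recorded ∷ byEdge ∷ byEdge ∷ byEdge ∷ byEdge ∷ byEdge ∷ []) ∷
                             []))
                         (identify 9 2 3 5 23 recorded recorded ▸
                          identify 9 3 2 6 21 recorded recorded ▸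
                          clash 5 6))
                      (identify 5 1 2 6 21 recorded recorded ▸
                       identify 5 2 1 9 19 recorded recorded ▸
                       clash 9 6)))
                (identify 4 0 1 3 16 recorded recorded ▸
                 identify 4 1 0 6 14 recorded recorded ▸
                 identify 4 3 0 12 15 recorded recorded ▸
                 openLink 5 1 2
                   (identify 5 1 2 6 18 recorded recorded ▸
                    identify 5 2 1 9 17 recorded recorded ▸
                    nonAdjacent 5 12 0 (recorded ∷ recorded ∷ byEdge ∷ byEdge ∷ []) ▸
                    openLink 6 1 4
                      (identify 6 1 4 5 20 recorded recorded ▸
                       identify 6 4 1 12 19 recorded recorded ▸
                       clash 5 12)
                      (identify 6 1 4 5 21 recorded recorded ▸
                       identify 6 4 1 12 19 recorded recorded ▸
                       identify 6 12 4 9 20 recorded recorded ▸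
                       openLink 9 2 3
                         (identify 9 2 3 5 23 recorded recorded ▸
                          identify 9 3 2 12 22 recorded recorded ▸
                          clash 5 12)
                         (identify 9 2 3 5 24 recorded recorded ▸
                          identify 9 3 2 12 22 recorded recorded ▸
                          identify 9 12 3 6 23 recorded recorded ▸
                          openLink 12 3 4
                            (identify 12 3 4 9 26 recorded recorded ▸
                             identify 12 4 3 6 25 recorded recorded ▸
                             match (# 3)
                               (1 ∷ 4 ∷ 6 ∷ 2 ∷ 3 ∷ 9 ∷ 0 ∷ 12 ∷ 5 ∷ [])
                               (7 ∷ 4 ∷ 2 ∷ 6 ∷ 5 ∷ 1 ∷ 8 ∷ 0 ∷ 3 ∷ [])
                               ((byEdge ∷ byEdge ∷ byEdge ∷ byEdge ∷ recorded ∷ recorded ∷ byEdge ∷ recorded ∷ byEdge ∷ []) ∷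
                                (byEdge ∷ byEdge ∷ byEdge ∷ recorded ∷ byEdge ∷ recorded ∷ byEdge ∷ byEdge ∷ recorded ∷ []) ∷
                                (byEdge ∷ byEdge ∷ byEdge ∷ recorded ∷ recorded ∷ byEdge ∷ recorded ∷ byEdge ∷ byEdge ∷ []) ∷
                                (byEdge ∷ recorded ∷ recorded ∷ byEdge ∷ byEdge ∷ byEdge ∷ byEdge ∷ recorded ∷ byEdge ∷ []) ∷
                                (recorded ∷ byEdge ∷ recorded ∷ byEdge ∷ byEdge ∷ byEdge ∷ byEdge ∷ byEdge ∷ recorded ∷ []) ∷
                                (recorded ∷ recorded ∷ byEdge ∷ byEdge ∷ byEdge ∷ byEdge ∷ recorded ∷ byEdge ∷ byEdge ∷ []) ∷
                                (byEdge ∷ byEdge ∷ recorded ∷ byEdge ∷ byEdge ∷ recorded ∷ byEdge ∷ recorded ∷ recorded ∷ []) ∷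
                                (recorded ∷ byEdge ∷ byEdge ∷ recorded ∷ byEdge ∷ byEdge ∷ recorded ∷ byEdge ∷ recorded ∷ []) ∷
                                (byEdge ∷ recorded ∷ byEdge ∷ byEdge ∷ recorded ∷ byEdge ∷ recorded ∷ recorded ∷ byEdge ∷ []) ∷
                                []))
                            (identify 12 3 4 9 27 recorded recorded ▸
                             identify 12 4 3 6 25 recorded recorded ▸
                             clash 9 6))))
                   (identify 5 1 2 6 19 recorded recorded ▸
                    identify 5 2 1 9 17 recorded recorded ▸
                    nonAdjacent 0 18 5 (recorded ∷ recorded ∷ (separatedBy 5) ∷ (separatedBy 9) ∷ []) ▸
                    openLink 6 1 4
                      (identify 6 1 4 5 21 recorded recorded ▸
                       identify 6 4 1 12 20 recorded recorded ▸
                       identify 6 5 1 12 18 recorded recorded ▸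
                       openLink 12 3 4
                         (identify 12 3 4 9 23 recorded recorded ▸
                          identify 12 4 3 6 22 recorded recorded ▸
                          clash 9 6)
                         (identify 12 3 4 9 24 recorded recorded ▸
                          identify 12 4 3 6 22 recorded recorded ▸
                          identify 12 6 4 5 23 recorded recorded ▸
                          openLink 9 2 3
                            (identify 9 2 3 5 26 recorded recorded ▸
                             identify 9 3 2 12 25 recorded recorded ▸
                             match (# 3)
                               (1 ∷ 2 ∷ 5 ∷ 4 ∷ 3 ∷ 12 ∷ 0 ∷ 9 ∷ 6 ∷ [])
                               (7 ∷ 6 ∷ 3 ∷ 4 ∷ 5 ∷ 1 ∷ 8 ∷ 0 ∷ 2 ∷ [])
                               ((byEdge ∷ byEdge ∷ byEdge ∷ byEdge ∷ recorded ∷ recorded ∷ byEdge ∷ recorded ∷ byEdge ∷ []) ∷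
                                (byEdge ∷ byEdge ∷ byEdge ∷ recorded ∷ byEdge ∷ recorded ∷ byEdge ∷ byEdge ∷ recorded ∷ []) ∷
                                (byEdge ∷ byEdge ∷ byEdge ∷ recorded ∷ recorded ∷ byEdge ∷ recorded ∷ byEdge ∷ byEdge ∷ []) ∷
                                (byEdge ∷ recorded ∷ recorded ∷ byEdge ∷ byEdge ∷ byEdge ∷ byEdge ∷ recorded ∷ byEdge ∷ []) ∷
                                (recorded ∷ byEdge ∷ recorded ∷ byEdge ∷ byEdge ∷ byEdge ∷ byEdge ∷ byEdge ∷ recorded ∷ []) ∷
                                (recorded ∷ recorded ∷ byEdge ∷ byEdge ∷ byEdge ∷ byEdge ∷ recorded ∷ byEdge ∷ byEdge ∷ []) ∷
                                (byEdge ∷ byEdge ∷ recorded ∷ byEdge ∷ byEdge ∷ recorded ∷ byEdge ∷ recorded ∷ recorded ∷ []) ∷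
                                (recorded ∷ byEdge ∷ byEdge ∷ recorded ∷ byEdge ∷ byEdge ∷ recorded ∷ byEdge ∷ recorded ∷ []) ∷
                                (byEdge ∷ recorded ∷ byEdge ∷ byEdge ∷ recorded ∷ byEdge ∷ recorded ∷ recorded ∷ byEdge ∷ []) ∷
                                []))
                            (identify 9 2 3 5 27 recorded recorded ▸
                             identify 9 3 2 12 25 recorded recorded ▸
                             clash 5 12)))
                      (identify 6 1 4 5 22 recorded recorded ▸
                       identify 6 4 1 12 20 recorded recorded ▸
                       identify 6 5 1 18 21 recorded recorded ▸
                       nonAdjacent 3 18 3 ((separatedBy 9) ∷ recorded ∷ byEdge ∷ byEdge ∷ recorded ∷ []) ▸
                       openLink 9 2 3
                         (identify 9 2 3 5 24 recorded recorded ▸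
                          identify 9 3 2 12 23 recorded recorded ▸
                          clash 5 12)
                         (identify 9 2 3 5 25 recorded recorded ▸
                          identify 9 3 2 12 23 recorded recorded ▸
                          identify 9 12 3 18 24 (separatedBy 5) recorded ▸
                          openLink 12 3 4
                            (identify 12 3 4 9 27 recorded recorded ▸
                             identify 12 4 3 6 26 recorded recorded ▸
                             clash 9 6)
                            (identify 12 3 4 9 28 recorded recorded ▸
                             identify 12 4 3 6 26 recorded recorded ▸
                             identify 12 6 4 18 27 recorded recorded ▸
                             openLink 18 5 6
                               (identify 18 5 6 9 30 recorded recorded ▸
                                identify 18 6 5 12 29 recorded recorded ▸
                                match (# 4)
                                  (0 ∷ 1 ∷ 2 ∷ 3 ∷ 4 ∷ 6 ∷ 5 ∷ 9 ∷ 12 ∷ 18 ∷ [])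
                                  (9 ∷ 8 ∷ 7 ∷ 6 ∷ 5 ∷ 3 ∷ 4 ∷ 2 ∷ 1 ∷ 0 ∷ [])
                                  ((byEdge ∷ byEdge ∷ byEdge ∷ byEdge ∷ byEdge ∷ recorded ∷ recorded ∷ recorded ∷ recorded ∷ (separatedBy 1) ∷ []) ∷
                                   (byEdge ∷ byEdge ∷ byEdge ∷ recorded ∷ byEdge ∷ byEdge ∷ byEdge ∷ recorded ∷ recorded ∷ recorded ∷ []) ∷
                                   (byEdge ∷ byEdge ∷ byEdge ∷ byEdge ∷ recorded ∷ recorded ∷ byEdge ∷ byEdge ∷ recorded ∷ recorded ∷ []) ∷
                                   (byEdge ∷ recorded ∷ byEdge ∷ byEdge ∷ byEdge ∷ recorded ∷ recorded ∷ byEdge ∷ byEdge ∷ recorded ∷ []) ∷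
                                   (byEdge ∷ byEdge ∷ recorded ∷ byEdge ∷ byEdge ∷ byEdge ∷ recorded ∷ recorded ∷ byEdge ∷ recorded ∷ []) ∷
                                   (recorded ∷ byEdge ∷ recorded ∷ recorded ∷ byEdge ∷ byEdge ∷ byEdge ∷ recorded ∷ byEdge ∷ byEdge ∷ []) ∷
                                   (recorded ∷ byEdge ∷ byEdge ∷ recorded ∷ recorded ∷ byEdge ∷ byEdge ∷ byEdge ∷ recorded ∷ byEdge ∷ []) ∷
                                   (recorded ∷ recorded ∷ byEdge ∷ byEdge ∷ recorded ∷ recorded ∷ byEdge ∷ byEdge ∷ byEdge ∷ byEdge ∷ []) ∷
                                   (recorded ∷ recorded ∷ recorded ∷ byEdge ∷ byEdge ∷ byEdge ∷ recorded ∷ byEdge ∷ byEdge ∷ byEdge ∷ []) ∷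
                                   ((separatedBy 9) ∷ recorded ∷ recorded ∷ recorded ∷ recorded ∷ byEdge ∷ byEdge ∷ byEdge ∷ byEdge ∷ byEdge ∷ []) ∷
                                   []))
                               (identify 18 5 6 9 31 recorded recorded ▸
                                identify 18 6 5 12 29 recorded recorded ▸
                                clash 9 12))))))))))
    (openLink 1 0 2
       (identify 1 0 2 5 7 recorded recorded ▸
        openLink 2 0 1
          (identify 2 0 1 3 9 recorded recorded ▸
           identify 2 1 0 6 8 recorded recorded ▸
           openLink 3 0 2
             (identify 3 0 2 4 11 recorded recorded ▸
              identify 3 2 0 6 10 recorded recorded ▸
              openLink 6 1 2
                (identify 6 1 2 5 13 recorded recorded ▸
                 identify 6 2 1 3 12 recorded recorded ▸
                 clash 5 3)
                (identify 6 1 2 5 14 recorded recorded ▸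
                 identify 6 2 1 3 12 recorded recorded ▸
                 identify 6 3 2 4 13 recorded recorded ▸
                 openLink 4 0 3
                   (identify 4 0 3 5 16 recorded recorded ▸
                    identify 4 3 0 6 15 recorded recorded ▸
                    openLink 5 0 1
                      (identify 5 0 1 4 18 recorded recorded ▸
                       identify 5 1 0 6 17 recorded recorded ▸
                       match (# 1)
                         (0 ∷ 6 ∷ 1 ∷ 2 ∷ 3 ∷ 4 ∷ 5 ∷ [])
                         (6 ∷ 2 ∷ 5 ∷ 4 ∷ 3 ∷ 1 ∷ 0 ∷ [])
                         ((byEdge ∷ recorded ∷ byEdge ∷ byEdge ∷ byEdge ∷ byEdge ∷ byEdge ∷ []) ∷
                          (recorded ∷ byEdge ∷ byEdge ∷ byEdge ∷ byEdge ∷ byEdge ∷ byEdge ∷ []) ∷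
                          (byEdge ∷ byEdge ∷ byEdge ∷ byEdge ∷ recorded ∷ recorded ∷ byEdge ∷ []) ∷
                          (byEdge ∷ byEdge ∷ byEdge ∷ byEdge ∷ byEdge ∷ recorded ∷ recorded ∷ []) ∷
                          (byEdge ∷ byEdge ∷ recorded ∷ byEdge ∷ byEdge ∷ byEdge ∷ recorded ∷ []) ∷
                          (byEdge ∷ byEdge ∷ recorded ∷ recorded ∷ byEdge ∷ byEdge ∷ byEdge ∷ []) ∷
                          (byEdge ∷ byEdge ∷ byEdge ∷ recorded ∷ recorded ∷ byEdge ∷ byEdge ∷ []) ∷
                          []))
                      (identify 5 0 1 4 19 recorded recorded ▸
                       identify 5 1 0 6 17 recorded recorded ▸
                       clash 4 6))
                   (identify 4 0 3 5 17 recorded recorded ▸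
                    identify 4 3 0 6 15 recorded recorded ▸
                    clash 6 5)))
             (identify 3 0 2 4 12 recorded recorded ▸
              identify 3 2 0 6 10 recorded recorded ▸
              nonAdjacent 1 11 2 (recorded ∷ recorded ∷ byEdge ∷ (separatedBy 3) ∷ []) ▸
              openLink 6 1 2
                (identify 6 1 2 5 14 recorded recorded ▸
                 identify 6 2 1 3 13 recorded recorded ▸
                 clash 5 3)
                (identify 6 1 2 5 15 recorded recorded ▸
                 identify 6 2 1 3 13 recorded recorded ▸
                 identify 6 3 2 11 14 recorded recorded ▸
                 openLink 5 0 1
                   (identify 5 0 1 4 17 recorded recorded ▸
                    identify 5 1 0 6 16 recorded recorded ▸
                    clash 4 6)
                   (identify 5 0 1 4 18 recorded recorded ▸
                    identify 5 1 0 6 16 recorded recorded ▸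
                    identify 5 6 1 11 17 recorded recorded ▸
                    openLink 4 0 3
                      (identify 4 0 3 5 20 recorded recorded ▸
                       identify 4 3 0 11 19 recorded recorded ▸
                       openLink 11 3 4
                         (identify 11 3 4 6 22 recorded recorded ▸
                          identify 11 4 3 5 21 recorded recorded ▸
                          match (# 2)
                            (1 ∷ 2 ∷ 0 ∷ 5 ∷ 6 ∷ 3 ∷ 4 ∷ 11 ∷ [])
                            (6 ∷ 5 ∷ 7 ∷ 2 ∷ 3 ∷ 4 ∷ 1 ∷ 0 ∷ [])
                            ((byEdge ∷ byEdge ∷ byEdge ∷ byEdge ∷ byEdge ∷ recorded ∷ recorded ∷ recorded ∷ []) ∷
                             (byEdge ∷ byEdge ∷ byEdge ∷ recorded ∷ byEdge ∷ byEdge ∷ recorded ∷ recorded ∷ []) ∷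
                             (byEdge ∷ byEdge ∷ byEdge ∷ byEdge ∷ recorded ∷ byEdge ∷ byEdge ∷ recorded ∷ []) ∷
                             (byEdge ∷ recorded ∷ byEdge ∷ byEdge ∷ byEdge ∷ recorded ∷ byEdge ∷ byEdge ∷ []) ∷
                             (byEdge ∷ byEdge ∷ recorded ∷ byEdge ∷ byEdge ∷ byEdge ∷ recorded ∷ byEdge ∷ []) ∷
                             (recorded ∷ byEdge ∷ byEdge ∷ recorded ∷ byEdge ∷ byEdge ∷ byEdge ∷ byEdge ∷ []) ∷
                             (recorded ∷ recorded ∷ byEdge ∷ byEdge ∷ recorded ∷ byEdge ∷ byEdge ∷ byEdge ∷ []) ∷
                             (recorded ∷ recorded ∷ recorded ∷ byEdge ∷ byEdge ∷ byEdge ∷ byEdge ∷ byEdge ∷ []) ∷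
                             []))
                         (identify 11 3 4 6 23 recorded recorded ▸
                          identify 11 4 3 5 21 recorded recorded ▸
                          clash 5 6))
                      (identify 4 0 3 5 21 recorded recorded ▸
                       identify 4 3 0 11 19 recorded recorded ▸
                       clash 11 5)))))
          (identify 2 0 1 3 10 recorded recorded ▸
           identify 2 1 0 6 8 recorded recorded ▸
           openLink 3 0 2
             (identify 3 0 2 4 12 recorded recorded ▸
              identify 3 2 0 9 11 recorded recorded ▸
              openLink 4 0 3
                (identify 4 0 3 5 14 recorded recorded ▸
                 identify 4 3 0 9 13 recorded recorded ▸
                 nonAdjacent 4 6 0 (recorded ∷ recorded ∷ byEdge ∷ byEdge ∷ []) ▸
                 openLink 5 0 1
                   (identify 5 0 1 4 16 recorded recorded ▸
                    identify 5 1 0 6 15 recorded recorded ▸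
                    clash 4 6)
                   (identify 5 0 1 4 17 recorded recorded ▸
                    identify 5 1 0 6 15 recorded recorded ▸
                    identify 5 6 1 9 16 recorded recorded ▸
                    openLink 9 2 3
                      (identify 9 2 3 6 19 recorded recorded ▸
                       identify 9 3 2 4 18 recorded recorded ▸
                       clash 4 6)
                      (identify 9 2 3 6 20 recorded recorded ▸
                       identify 9 3 2 4 18 recorded recorded ▸
                       identify 9 4 3 5 19 recorded recorded ▸
                       openLink 6 1 2
                         (identify 6 1 2 5 22 recorded recorded ▸
                          identify 6 2 1 9 21 recorded recorded ▸
                          match (# 2)
                            (1 ∷ 6 ∷ 2 ∷ 0 ∷ 5 ∷ 9 ∷ 3 ∷ 4 ∷ [])
                            (6 ∷ 0 ∷ 5 ∷ 7 ∷ 2 ∷ 1 ∷ 4 ∷ 3 ∷ [])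
                            ((byEdge ∷ byEdge ∷ byEdge ∷ byEdge ∷ byEdge ∷ recorded ∷ recorded ∷ recorded ∷ []) ∷
                             (byEdge ∷ byEdge ∷ byEdge ∷ recorded ∷ byEdge ∷ byEdge ∷ recorded ∷ recorded ∷ []) ∷
                             (byEdge ∷ byEdge ∷ byEdge ∷ byEdge ∷ recorded ∷ byEdge ∷ byEdge ∷ recorded ∷ []) ∷
                             (byEdge ∷ recorded ∷ byEdge ∷ byEdge ∷ byEdge ∷ recorded ∷ byEdge ∷ byEdge ∷ []) ∷
                             (byEdge ∷ byEdge ∷ recorded ∷ byEdge ∷ byEdge ∷ byEdge ∷ recorded ∷ byEdge ∷ []) ∷
                             (recorded ∷ byEdge ∷ byEdge ∷ recorded ∷ byEdge ∷ byEdge ∷ byEdge ∷ byEdge ∷ []) ∷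
                             (recorded ∷ recorded ∷ byEdge ∷ byEdge ∷ recorded ∷ byEdge ∷ byEdge ∷ byEdge ∷ []) ∷
                             (recorded ∷ recorded ∷ recorded ∷ byEdge ∷ byEdge ∷ byEdge ∷ byEdge ∷ byEdge ∷ []) ∷
                             []))
                         (identify 6 1 2 5 23 recorded recorded ▸
                          identify 6 2 1 9 21 recorded recorded ▸
                          clash 9 5))))
                (identify 4 0 3 5 15 recorded recorded ▸
                 identify 4 3 0 9 13 recorded recorded ▸
                 openLink 5 0 1
                   (identify 5 0 1 4 17 recorded recorded ▸
                    identify 5 1 0 6 16 recorded recorded ▸
                    identify 5 4 0 6 14 recorded recorded ▸
                    openLink 6 1 2
                      (identify 6 1 2 5 19 recorded recorded ▸
                       identify 6 2 1 9 18 recorded recorded ▸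
                       clash 9 5)
                      (identify 6 1 2 5 20 recorded recorded ▸
                       identify 6 2 1 9 18 recorded recorded ▸
                       identify 6 9 2 4 19 recorded recorded ▸
                       openLink 9 2 3
                         (identify 9 2 3 6 22 recorded recorded ▸
                          identify 9 3 2 4 21 recorded recorded ▸
                          match (# 2)
                            (1 ∷ 5 ∷ 0 ∷ 2 ∷ 6 ∷ 4 ∷ 3 ∷ 9 ∷ [])
                            (6 ∷ 2 ∷ 7 ∷ 5 ∷ 1 ∷ 3 ∷ 4 ∷ 0 ∷ [])
                            ((byEdge ∷ byEdge ∷ byEdge ∷ byEdge ∷ byEdge ∷ recorded ∷ recorded ∷ recorded ∷ []) ∷
                             (byEdge ∷ byEdge ∷ byEdge ∷ recorded ∷ byEdge ∷ byEdge ∷ recorded ∷ recorded ∷ []) ∷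
                             (byEdge ∷ byEdge ∷ byEdge ∷ byEdge ∷ recorded ∷ byEdge ∷ byEdge ∷ recorded ∷ []) ∷
                             (byEdge ∷ recorded ∷ byEdge ∷ byEdge ∷ byEdge ∷ recorded ∷ byEdge ∷ byEdge ∷ []) ∷
                             (byEdge ∷ byEdge ∷ recorded ∷ byEdge ∷ byEdge ∷ byEdge ∷ recorded ∷ byEdge ∷ []) ∷
                             (recorded ∷ byEdge ∷ byEdge ∷ recorded ∷ byEdge ∷ byEdge ∷ byEdge ∷ byEdge ∷ []) ∷
                             (recorded ∷ recorded ∷ byEdge ∷ byEdge ∷ recorded ∷ byEdge ∷ byEdge ∷ byEdge ∷ []) ∷
                             (recorded ∷ recorded ∷ recorded ∷ byEdge ∷ byEdge ∷ byEdge ∷ byEdge ∷ byEdge ∷ []) ∷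
                             []))
                         (identify 9 2 3 6 23 recorded recorded ▸
                          identify 9 3 2 4 21 recorded recorded ▸
                          clash 4 6)))
                   (identify 5 0 1 4 18 recorded recorded ▸
                    identify 5 1 0 6 16 recorded recorded ▸
                    identify 5 4 0 14 17 recorded recorded ▸
                    nonAdjacent 2 14 3 (recorded ∷ recorded ∷ byEdge ∷ byEdge ∷ recorded ∷ []) ▸
                    openLink 6 1 2
                      (identify 6 1 2 5 20 recorded recorded ▸
                       identify 6 2 1 9 19 recorded recorded ▸
                       clash 9 5)
                      (identify 6 1 2 5 21 recorded recorded ▸
                       identify 6 2 1 9 19 recorded recorded ▸
                       identify 6 9 2 14 20 (separatedBy 4) recorded ▸
                       openLink 9 2 3
                         (identify 9 2 3 6 23 recorded recorded ▸
                          identify 9 3 2 4 22 recorded recorded ▸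
                          clash 4 6)
                         (identify 9 2 3 6 24 recorded recorded ▸
                          identify 9 3 2 4 22 recorded recorded ▸
                          identify 9 4 3 14 23 recorded recorded ▸
                          openLink 14 4 5
                            (identify 14 4 5 9 26 recorded recorded ▸
                             identify 14 5 4 6 25 recorded recorded ▸
                             match (# 3)
                               (0 ∷ 4 ∷ 5 ∷ 2 ∷ 9 ∷ 6 ∷ 3 ∷ 14 ∷ 1 ∷ [])
                               (8 ∷ 4 ∷ 3 ∷ 6 ∷ 1 ∷ 2 ∷ 5 ∷ 0 ∷ 7 ∷ [])
                               ((byEdge ∷ byEdge ∷ byEdge ∷ byEdge ∷ recorded ∷ recorded ∷ byEdge ∷ recorded ∷ byEdge ∷ []) ∷
                                (byEdge ∷ byEdge ∷ byEdge ∷ recorded ∷ byEdge ∷ recorded ∷ byEdge ∷ byEdge ∷ recorded ∷ []) ∷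
                                (byEdge ∷ byEdge ∷ byEdge ∷ recorded ∷ recorded ∷ byEdge ∷ recorded ∷ byEdge ∷ byEdge ∷ []) ∷
                                (byEdge ∷ recorded ∷ recorded ∷ byEdge ∷ byEdge ∷ byEdge ∷ byEdge ∷ recorded ∷ byEdge ∷ []) ∷
                                (recorded ∷ byEdge ∷ recorded ∷ byEdge ∷ byEdge ∷ byEdge ∷ byEdge ∷ byEdge ∷ recorded ∷ []) ∷
                                (recorded ∷ recorded ∷ byEdge ∷ byEdge ∷ byEdge ∷ byEdge ∷ recorded ∷ byEdge ∷ byEdge ∷ []) ∷
                                (byEdge ∷ byEdge ∷ recorded ∷ byEdge ∷ byEdge ∷ recorded ∷ byEdge ∷ recorded ∷ recorded ∷ []) ∷
                                (recorded ∷ byEdge ∷ byEdge ∷ recorded ∷ byEdge ∷ byEdge ∷ recorded ∷ byEdge ∷ recorded ∷ []) ∷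
                                (byEdge ∷ recorded ∷ byEdge ∷ byEdge ∷ recorded ∷ byEdge ∷ recorded ∷ recorded ∷ byEdge ∷ []) ∷
                                []))
                            (identify 14 4 5 9 27 recorded recorded ▸
                             identify 14 5 4 6 25 recorded recorded ▸
                             clash 9 6))))))
             (identify 3 0 2 4 13 recorded recorded ▸
              identify 3 2 0 9 11 recorded recorded ▸
              nonAdjacent 1 12 2 (recorded ∷ recorded ∷ (separatedBy 3) ∷ (separatedBy 3) ∷ []) ▸
              openLink 4 0 3
                (identify 4 0 3 5 15 recorded recorded ▸
                 identify 4 3 0 12 14 recorded recorded ▸
                 nonAdjacent 4 6 0 (recorded ∷ recorded ∷ (separatedBy 1) ∷ byEdge ∷ []) ▸
                 openLink 5 0 1
                   (identify 5 0 1 4 17 recorded recorded ▸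
                    identify 5 1 0 6 16 recorded recorded ▸
                    clash 4 6)
                   (identify 5 0 1 4 18 recorded recorded ▸
                    identify 5 1 0 6 16 recorded recorded ▸
                    identify 5 4 0 12 17 recorded recorded ▸
                    nonAdjacent 5 9 0 (recorded ∷ recorded ∷ byEdge ∷ byEdge ∷ recorded ∷ []) ▸
                    openLink 6 1 2
                      (identify 6 1 2 5 20 recorded recorded ▸
                       identify 6 2 1 9 19 recorded recorded ▸
                       clash 9 5)
                      (identify 6 1 2 5 21 recorded recorded ▸
                       identify 6 2 1 9 19 recorded recorded ▸
                       identify 6 9 2 12 20 recorded recorded ▸
                       openLink 12 3 4
                         (identify 12 3 4 9 23 recorded recorded ▸
                          identify 12 4 3 5 22 recorded recorded ▸
                          clash 9 5)
                         (identify 12 3 4 9 24 recorded recorded ▸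
                          identify 12 4 3 5 22 recorded recorded ▸
                          identify 12 5 4 6 23 recorded recorded ▸
                          openLink 9 2 3
                            (identify 9 2 3 6 26 recorded recorded ▸
                             identify 9 3 2 12 25 recorded recorded ▸
                             match (# 3)
                               (0 ∷ 2 ∷ 3 ∷ 5 ∷ 6 ∷ 12 ∷ 1 ∷ 9 ∷ 4 ∷ [])
                               (8 ∷ 6 ∷ 5 ∷ 3 ∷ 2 ∷ 1 ∷ 7 ∷ 0 ∷ 4 ∷ [])
                               ((byEdge ∷ byEdge ∷ byEdge ∷ byEdge ∷ recorded ∷ recorded ∷ byEdge ∷ recorded ∷ byEdge ∷ []) ∷
                                (byEdge ∷ byEdge ∷ byEdge ∷ recorded ∷ byEdge ∷ recorded ∷ byEdge ∷ byEdge ∷ recorded ∷ []) ∷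
                                (byEdge ∷ byEdge ∷ byEdge ∷ recorded ∷ recorded ∷ byEdge ∷ recorded ∷ byEdge ∷ byEdge ∷ []) ∷
                                (byEdge ∷ recorded ∷ recorded ∷ byEdge ∷ byEdge ∷ byEdge ∷ byEdge ∷ recorded ∷ byEdge ∷ []) ∷
                                (recorded ∷ byEdge ∷ recorded ∷ byEdge ∷ byEdge ∷ byEdge ∷ byEdge ∷ byEdge ∷ recorded ∷ []) ∷
                                (recorded ∷ recorded ∷ byEdge ∷ byEdge ∷ byEdge ∷ byEdge ∷ recorded ∷ byEdge ∷ byEdge ∷ []) ∷
                                (byEdge ∷ byEdge ∷ recorded ∷ byEdge ∷ byEdge ∷ recorded ∷ byEdge ∷ recorded ∷ recorded ∷ []) ∷
                                (recorded ∷ byEdge ∷ byEdge ∷ recorded ∷ byEdge ∷ byEdge ∷ recorded ∷ byEdge ∷ recorded ∷ []) ∷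
                                (byEdge ∷ recorded ∷ byEdge ∷ byEdge ∷ recorded ∷ byEdge ∷ recorded ∷ recorded ∷ byEdge ∷ []) ∷
                                []))
                            (identify 9 2 3 6 27 recorded recorded ▸
                             identify 9 3 2 12 25 recorded recorded ▸
                             clash 6 12)))))
                (identify 4 0 3 5 16 recorded recorded ▸
                 identify 4 3 0 12 14 recorded recorded ▸
                 openLink 5 0 1
                   (identify 5 0 1 4 18 recorded recorded ▸
                    identify 5 1 0 6 17 recorded recorded ▸
                    identify 5 4 0 6 15 recorded recorded ▸
                    nonAdjacent 5 9 0 (recorded ∷ recorded ∷ byEdge ∷ recorded ∷ []) ▸
                    openLink 6 1 2
                      (identify 6 1 2 5 20 recorded recorded ▸
                       identify 6 2 1 9 19 recorded recorded ▸
                       clash 9 5)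
                      (identify 6 1 2 5 21 recorded recorded ▸
                       identify 6 2 1 9 19 recorded recorded ▸
                       identify 6 9 2 12 20 recorded recorded ▸
                       clash 5 12))
                   (identify 5 0 1 4 19 recorded recorded ▸
                    identify 5 1 0 6 17 recorded recorded ▸
                    identify 5 4 0 15 18 recorded recorded ▸
                    nonAdjacent 5 9 0 (recorded ∷ recorded ∷ byEdge ∷ (separatedBy 3) ∷ recorded ∷ []) ▸
                    nonAdjacent 2 15 3 (recorded ∷ recorded ∷ byEdge ∷ (separatedBy 4) ∷ recorded ∷ []) ▸
                    openLink 6 1 2
                      (identify 6 1 2 5 21 recorded recorded ▸
                       identify 6 2 1 9 20 recorded recorded ▸
                       clash 9 5)
                      (identify 6 1 2 5 22 recorded recorded ▸
                       identify 6 2 1 9 20 recorded recorded ▸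
                       identify 6 5 1 15 21 recorded recorded ▸
                       nonAdjacent 6 12 0 ((separatedBy 9) ∷ recorded ∷ byEdge ∷ byEdge ∷ recorded ∷ []) ▸
                       openLink 9 2 3
                         (identify 9 2 3 6 24 recorded recorded ▸
                          identify 9 3 2 12 23 recorded recorded ▸
                          clash 6 12)
                         (identify 9 2 3 6 25 recorded recorded ▸
                          identify 9 3 2 12 23 recorded recorded ▸
                          identify 9 12 3 15 24 recorded recorded ▸
                          openLink 15 4 5
                            (identify 15 4 5 12 27 recorded recorded ▸
                             identify 15 5 4 6 26 recorded recorded ▸
                             clash 6 12)
                            (identify 15 4 5 12 28 recorded recorded ▸
                             identify 15 5 4 6 26 recorded recorded ▸
                             identify 15 6 5 9 27 recorded recorded ▸
                             openLink 12 3 4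
                               (identify 12 3 4 9 30 recorded recorded ▸
                                identify 12 4 3 15 29 recorded recorded ▸
                                match (# 4)
                                  (1 ∷ 0 ∷ 2 ∷ 6 ∷ 5 ∷ 4 ∷ 3 ∷ 9 ∷ 15 ∷ 12 ∷ [])
                                  (8 ∷ 9 ∷ 7 ∷ 3 ∷ 4 ∷ 5 ∷ 6 ∷ 2 ∷ 1 ∷ 0 ∷ [])
                                  ((byEdge ∷ byEdge ∷ byEdge ∷ byEdge ∷ byEdge ∷ recorded ∷ recorded ∷ recorded ∷ recorded ∷ (separatedBy 0) ∷ []) ∷
                                   (byEdge ∷ byEdge ∷ byEdge ∷ recorded ∷ byEdge ∷ byEdge ∷ byEdge ∷ recorded ∷ recorded ∷ recorded ∷ []) ∷
                                   (byEdge ∷ byEdge ∷ byEdge ∷ byEdge ∷ recorded ∷ recorded ∷ byEdge ∷ byEdge ∷ recorded ∷ recorded ∷ []) ∷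
                                   (byEdge ∷ recorded ∷ byEdge ∷ byEdge ∷ byEdge ∷ recorded ∷ recorded ∷ byEdge ∷ byEdge ∷ recorded ∷ []) ∷
                                   (byEdge ∷ byEdge ∷ recorded ∷ byEdge ∷ byEdge ∷ byEdge ∷ recorded ∷ recorded ∷ byEdge ∷ recorded ∷ []) ∷
                                   (recorded ∷ byEdge ∷ recorded ∷ recorded ∷ byEdge ∷ byEdge ∷ byEdge ∷ recorded ∷ byEdge ∷ byEdge ∷ []) ∷
                                   (recorded ∷ byEdge ∷ byEdge ∷ recorded ∷ recorded ∷ byEdge ∷ byEdge ∷ byEdge ∷ recorded ∷ byEdge ∷ []) ∷
                                   (recorded ∷ recorded ∷ byEdge ∷ byEdge ∷ recorded ∷ recorded ∷ byEdge ∷ byEdge ∷ byEdge ∷ byEdge ∷ []) ∷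
                                   (recorded ∷ recorded ∷ recorded ∷ byEdge ∷ byEdge ∷ byEdge ∷ recorded ∷ byEdge ∷ byEdge ∷ byEdge ∷ []) ∷
                                   ((separatedBy 9) ∷ recorded ∷ recorded ∷ recorded ∷ recorded ∷ byEdge ∷ byEdge ∷ byEdge ∷ byEdge ∷ byEdge ∷ []) ∷
                                   []))
                               (identify 12 3 4 9 31 recorded recorded ▸
                                identify 12 4 3 15 29 recorded recorded ▸
                                clash 15 9)))))))))
       (identify 1 0 2 5 8 recorded recorded ▸
        openLink 2 0 1
          (identify 2 0 1 3 10 recorded recorded ▸
           identify 2 1 0 6 9 recorded recorded ▸
           openLink 3 0 2
             (identify 3 0 2 4 12 recorded recorded ▸
              identify 3 2 0 6 11 recorded recorded ▸
              nonAdjacent 3 7 0 (recorded ∷ recorded ∷ byEdge ∷ (separatedBy 1) ∷ []) ▸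
              openLink 6 1 2
                (identify 6 1 2 7 14 recorded recorded ▸
                 identify 6 2 1 3 13 recorded recorded ▸
                 clash 3 7)
                (identify 6 1 2 7 15 recorded recorded ▸
                 identify 6 2 1 3 13 recorded recorded ▸
                 identify 6 3 2 4 14 recorded recorded ▸
                 openLink 4 0 3
                   (identify 4 0 3 5 17 recorded recorded ▸
                    identify 4 3 0 6 16 recorded recorded ▸
                    clash 6 5)
                   (identify 4 0 3 5 18 recorded recorded ▸
                    identify 4 3 0 6 16 recorded recorded ▸
                    identify 4 6 3 7 17 recorded recorded ▸
                    openLink 5 0 1
                      (identify 5 0 1 4 20 recorded recorded ▸
                       identify 5 1 0 7 19 recorded recorded ▸
                       openLink 7 1 5
                         (identify 7 1 5 6 22 recorded recorded ▸
                          identify 7 5 1 4 21 recorded recorded ▸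
                          match (# 2)
                            (2 ∷ 3 ∷ 0 ∷ 1 ∷ 6 ∷ 4 ∷ 5 ∷ 7 ∷ [])
                            (5 ∷ 4 ∷ 7 ∷ 6 ∷ 3 ∷ 2 ∷ 1 ∷ 0 ∷ [])
                            ((byEdge ∷ byEdge ∷ byEdge ∷ byEdge ∷ byEdge ∷ recorded ∷ recorded ∷ recorded ∷ []) ∷
                             (byEdge ∷ byEdge ∷ byEdge ∷ recorded ∷ byEdge ∷ byEdge ∷ recorded ∷ recorded ∷ []) ∷
                             (byEdge ∷ byEdge ∷ byEdge ∷ byEdge ∷ recorded ∷ byEdge ∷ byEdge ∷ recorded ∷ []) ∷
                             (byEdge ∷ recorded ∷ byEdge ∷ byEdge ∷ byEdge ∷ recorded ∷ byEdge ∷ byEdge ∷ []) ∷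
                             (byEdge ∷ byEdge ∷ recorded ∷ byEdge ∷ byEdge ∷ byEdge ∷ recorded ∷ byEdge ∷ []) ∷
                             (recorded ∷ byEdge ∷ byEdge ∷ recorded ∷ byEdge ∷ byEdge ∷ byEdge ∷ byEdge ∷ []) ∷
                             (recorded ∷ recorded ∷ byEdge ∷ byEdge ∷ recorded ∷ byEdge ∷ byEdge ∷ byEdge ∷ []) ∷
                             (recorded ∷ recorded ∷ recorded ∷ byEdge ∷ byEdge ∷ byEdge ∷ byEdge ∷ byEdge ∷ []) ∷
                             []))
                         (identify 7 1 5 6 23 recorded recorded ▸
                          identify 7 5 1 4 21 recorded recorded ▸
                          clash 4 6))
                      (identify 5 0 1 4 21 recorded recorded ▸
                       identify 5 1 0 7 19 recorded recorded ▸
                       clash 7 4))))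
             (identify 3 0 2 4 13 recorded recorded ▸
              identify 3 2 0 6 11 recorded recorded ▸
              openLink 6 1 2
                (identify 6 1 2 7 15 recorded recorded ▸
                 identify 6 2 1 3 14 recorded recorded ▸
                 identify 6 3 2 7 12 recorded recorded ▸
                 openLink 7 1 5
                   (identify 7 1 5 6 17 recorded recorded ▸
                    identify 7 5 1 4 16 recorded recorded ▸
                    clash 4 6)
                   (identify 7 1 5 6 18 recorded recorded ▸
                    identify 7 5 1 4 16 recorded recorded ▸
                    identify 7 4 5 3 17 recorded recorded ▸
                    openLink 4 0 3
                      (identify 4 0 3 5 20 recorded recorded ▸
                       identify 4 3 0 7 19 recorded recorded ▸
                       openLink 5 0 1
                         (identify 5 0 1 4 22 recorded recorded ▸
                          identify 5 1 0 7 21 recorded recorded ▸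
                          match (# 2)
                            (2 ∷ 6 ∷ 1 ∷ 0 ∷ 3 ∷ 7 ∷ 5 ∷ 4 ∷ [])
                            (5 ∷ 3 ∷ 6 ∷ 7 ∷ 4 ∷ 2 ∷ 0 ∷ 1 ∷ [])
                            ((byEdge ∷ byEdge ∷ byEdge ∷ byEdge ∷ byEdge ∷ recorded ∷ recorded ∷ recorded ∷ []) ∷
                             (byEdge ∷ byEdge ∷ byEdge ∷ recorded ∷ byEdge ∷ byEdge ∷ recorded ∷ recorded ∷ []) ∷
                             (byEdge ∷ byEdge ∷ byEdge ∷ byEdge ∷ recorded ∷ byEdge ∷ byEdge ∷ recorded ∷ []) ∷
                             (byEdge ∷ recorded ∷ byEdge ∷ byEdge ∷ byEdge ∷ recorded ∷ byEdge ∷ byEdge ∷ []) ∷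
                             (byEdge ∷ byEdge ∷ recorded ∷ byEdge ∷ byEdge ∷ byEdge ∷ recorded ∷ byEdge ∷ []) ∷
                             (recorded ∷ byEdge ∷ byEdge ∷ recorded ∷ byEdge ∷ byEdge ∷ byEdge ∷ byEdge ∷ []) ∷
                             (recorded ∷ recorded ∷ byEdge ∷ byEdge ∷ recorded ∷ byEdge ∷ byEdge ∷ byEdge ∷ []) ∷
                             (recorded ∷ recorded ∷ recorded ∷ byEdge ∷ byEdge ∷ byEdge ∷ byEdge ∷ byEdge ∷ []) ∷
                             []))
                         (identify 5 0 1 4 23 recorded recorded ▸
                          identify 5 1 0 7 21 recorded recorded ▸
                          clash 7 4))
                      (identify 4 0 3 5 21 recorded recorded ▸
                       identify 4 3 0 7 19 recorded recorded ▸
                       clash 5 7)))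
                (identify 6 1 2 7 16 recorded recorded ▸
                 identify 6 2 1 3 14 recorded recorded ▸
                 identify 6 3 2 12 15 recorded recorded ▸
                 openLink 4 0 3
                   (identify 4 0 3 5 18 recorded recorded ▸
                    identify 4 3 0 12 17 recorded recorded ▸
                    nonAdjacent 4 7 0 (recorded ∷ recorded ∷ byEdge ∷ byEdge ∷ []) ▸
                    openLink 5 0 1
                      (identify 5 0 1 4 20 recorded recorded ▸
                       identify 5 1 0 7 19 recorded recorded ▸
                       clash 7 4)
                      (identify 5 0 1 4 21 recorded recorded ▸
                       identify 5 1 0 7 19 recorded recorded ▸
                       identify 5 7 1 12 20 recorded recorded ▸
                       openLink 12 3 4
                         (identify 12 3 4 6 23 recorded recorded ▸
                          identify 12 4 3 5 22 recorded recorded ▸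
                          clash 5 6)
                         (identify 12 3 4 6 24 recorded recorded ▸
                          identify 12 4 3 5 22 recorded recorded ▸
                          identify 12 5 4 7 23 recorded recorded ▸
                          openLink 7 1 5
                            (identify 7 1 5 6 26 recorded recorded ▸
                             identify 7 5 1 12 25 recorded recorded ▸
                             match (# 3)
                               (0 ∷ 1 ∷ 5 ∷ 3 ∷ 6 ∷ 12 ∷ 2 ∷ 7 ∷ 4 ∷ [])
                               (8 ∷ 7 ∷ 2 ∷ 5 ∷ 4 ∷ 1 ∷ 6 ∷ 0 ∷ 3 ∷ [])
                               ((byEdge ∷ byEdge ∷ byEdge ∷ byEdge ∷ recorded ∷ recorded ∷ byEdge ∷ recorded ∷ byEdge ∷ []) ∷
                                (byEdge ∷ byEdge ∷ byEdge ∷ recorded ∷ byEdge ∷ recorded ∷ byEdge ∷ byEdge ∷ recorded ∷ []) ∷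
                                (byEdge ∷ byEdge ∷ byEdge ∷ recorded ∷ recorded ∷ byEdge ∷ recorded ∷ byEdge ∷ byEdge ∷ []) ∷
                                (byEdge ∷ recorded ∷ recorded ∷ byEdge ∷ byEdge ∷ byEdge ∷ byEdge ∷ recorded ∷ byEdge ∷ []) ∷
                                (recorded ∷ byEdge ∷ recorded ∷ byEdge ∷ byEdge ∷ byEdge ∷ byEdge ∷ byEdge ∷ recorded ∷ []) ∷
                                (recorded ∷ recorded ∷ byEdge ∷ byEdge ∷ byEdge ∷ byEdge ∷ recorded ∷ byEdge ∷ byEdge ∷ []) ∷
                                (byEdge ∷ byEdge ∷ recorded ∷ byEdge ∷ byEdge ∷ recorded ∷ byEdge ∷ recorded ∷ recorded ∷ []) ∷
                                (recorded ∷ byEdge ∷ byEdge ∷ recorded ∷ byEdge ∷ byEdge ∷ recorded ∷ byEdge ∷ recorded ∷ []) ∷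
                                (byEdge ∷ recorded ∷ byEdge ∷ byEdge ∷ recorded ∷ byEdge ∷ recorded ∷ recorded ∷ byEdge ∷ []) ∷
                                []))
                            (identify 7 1 5 6 27 recorded recorded ▸
                             identify 7 5 1 12 25 recorded recorded ▸
                             clash 6 12))))
                   (identify 4 0 3 5 19 recorded recorded ▸
                    identify 4 3 0 12 17 recorded recorded ▸
                    nonAdjacent 2 18 3 (recorded ∷ (separatedBy 4) ∷ (separatedBy 5) ∷ recorded ∷ []) ▸
                    openLink 5 0 1
                      (identify 5 0 1 4 21 recorded recorded ▸
                       identify 5 1 0 7 20 recorded recorded ▸
                       identify 5 4 0 7 18 recorded recorded ▸
                       openLink 7 1 5
                         (identify 7 1 5 6 23 recorded recorded ▸
                          identify 7 5 1 4 22 recorded recorded ▸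
                          clash 4 6)
                         (identify 7 1 5 6 24 recorded recorded ▸
                          identify 7 5 1 4 22 recorded recorded ▸
                          identify 7 4 5 12 23 recorded recorded ▸
                          openLink 12 3 4
                            (identify 12 3 4 6 26 recorded recorded ▸
                             identify 12 4 3 7 25 recorded recorded ▸
                             match (# 3)
                               (0 ∷ 3 ∷ 4 ∷ 1 ∷ 6 ∷ 7 ∷ 2 ∷ 12 ∷ 5 ∷ [])
                               (8 ∷ 5 ∷ 3 ∷ 7 ∷ 4 ∷ 1 ∷ 6 ∷ 0 ∷ 2 ∷ [])
                               ((byEdge ∷ byEdge ∷ byEdge ∷ byEdge ∷ recorded ∷ recorded ∷ byEdge ∷ recorded ∷ byEdge ∷ []) ∷
                                (byEdge ∷ byEdge ∷ byEdge ∷ recorded ∷ byEdge ∷ recorded ∷ byEdge ∷ byEdge ∷ recorded ∷ []) ∷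
                                (byEdge ∷ byEdge ∷ byEdge ∷ recorded ∷ recorded ∷ byEdge ∷ recorded ∷ byEdge ∷ byEdge ∷ []) ∷
                                (byEdge ∷ recorded ∷ recorded ∷ byEdge ∷ byEdge ∷ byEdge ∷ byEdge ∷ recorded ∷ byEdge ∷ []) ∷
                                (recorded ∷ byEdge ∷ recorded ∷ byEdge ∷ byEdge ∷ byEdge ∷ byEdge ∷ byEdge ∷ recorded ∷ []) ∷
                                (recorded ∷ recorded ∷ byEdge ∷ byEdge ∷ byEdge ∷ byEdge ∷ recorded ∷ byEdge ∷ byEdge ∷ []) ∷
                                (byEdge ∷ byEdge ∷ recorded ∷ byEdge ∷ byEdge ∷ recorded ∷ byEdge ∷ recorded ∷ recorded ∷ []) ∷
                                (recorded ∷ byEdge ∷ byEdge ∷ recorded ∷ byEdge ∷ byEdge ∷ recorded ∷ byEdge ∷ recorded ∷ []) ∷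
                                (byEdge ∷ recorded ∷ byEdge ∷ byEdge ∷ recorded ∷ byEdge ∷ recorded ∷ recorded ∷ byEdge ∷ []) ∷
                                []))
                            (identify 12 3 4 6 27 recorded recorded ▸
                             identify 12 4 3 7 25 recorded recorded ▸
                             clash 6 7)))
                      (identify 5 0 1 4 22 recorded recorded ▸
                       identify 5 1 0 7 20 recorded recorded ▸
                       identify 5 4 0 18 21 recorded recorded ▸
                       nonAdjacent 6 18 2 (recorded ∷ (separatedBy 5) ∷ recorded ∷ byEdge ∷ byEdge ∷ []) ▸
                       openLink 7 1 5
                         (identify 7 1 5 6 24 recorded recorded ▸
                          identify 7 5 1 18 23 recorded recorded ▸
                          clash 6 18)
                         (identify 7 1 5 6 25 recorded recorded ▸
                          identify 7 5 1 18 23 recorded recorded ▸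
                          identify 7 18 5 12 24 recorded recorded ▸
                          openLink 12 3 4
                            (identify 12 3 4 6 27 recorded recorded ▸
                             identify 12 4 3 18 26 recorded recorded ▸
                             clash 6 18)
                            (identify 12 3 4 6 28 recorded recorded ▸
                             identify 12 4 3 18 26 recorded recorded ▸
                             identify 12 18 4 7 27 recorded recorded ▸
                             openLink 18 4 5
                               (identify 18 4 5 12 30 recorded recorded ▸
                                identify 18 5 4 7 29 recorded recorded ▸
                                match (# 4)
                                  (2 ∷ 0 ∷ 1 ∷ 6 ∷ 3 ∷ 4 ∷ 5 ∷ 7 ∷ 12 ∷ 18 ∷ [])
                                  (7 ∷ 9 ∷ 8 ∷ 5 ∷ 6 ∷ 4 ∷ 3 ∷ 2 ∷ 1 ∷ 0 ∷ [])
                                  ((byEdge ∷ byEdge ∷ byEdge ∷ byEdge ∷ byEdge ∷ recorded ∷ recorded ∷ recorded ∷ recorded ∷ (separatedBy 0) ∷ []) ∷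
                                   (byEdge ∷ byEdge ∷ byEdge ∷ recorded ∷ byEdge ∷ byEdge ∷ byEdge ∷ recorded ∷ recorded ∷ recorded ∷ []) ∷
                                   (byEdge ∷ byEdge ∷ byEdge ∷ byEdge ∷ recorded ∷ recorded ∷ byEdge ∷ byEdge ∷ recorded ∷ recorded ∷ []) ∷
                                   (byEdge ∷ recorded ∷ byEdge ∷ byEdge ∷ byEdge ∷ recorded ∷ recorded ∷ byEdge ∷ byEdge ∷ recorded ∷ []) ∷
                                   (byEdge ∷ byEdge ∷ recorded ∷ byEdge ∷ byEdge ∷ byEdge ∷ recorded ∷ recorded ∷ byEdge ∷ recorded ∷ []) ∷
                                   (recorded ∷ byEdge ∷ recorded ∷ recorded ∷ byEdge ∷ byEdge ∷ byEdge ∷ recorded ∷ byEdge ∷ byEdge ∷ []) ∷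
                                   (recorded ∷ byEdge ∷ byEdge ∷ recorded ∷ recorded ∷ byEdge ∷ byEdge ∷ byEdge ∷ recorded ∷ byEdge ∷ []) ∷
                                   (recorded ∷ recorded ∷ byEdge ∷ byEdge ∷ recorded ∷ recorded ∷ byEdge ∷ byEdge ∷ byEdge ∷ byEdge ∷ []) ∷
                                   (recorded ∷ recorded ∷ recorded ∷ byEdge ∷ byEdge ∷ byEdge ∷ recorded ∷ byEdge ∷ byEdge ∷ byEdge ∷ []) ∷
                                   ((separatedBy 5) ∷ recorded ∷ recorded ∷ recorded ∷ recorded ∷ byEdge ∷ byEdge ∷ byEdge ∷ byEdge ∷ byEdge ∷ []) ∷
                                   []))
                               (identify 18 4 5 12 31 recorded recorded ▸
                                identify 18 5 4 7 29 recorded recorded ▸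
                                clash 7 12))))))))
          (identify 2 0 1 3 11 recorded recorded ▸
           identify 2 1 0 6 9 recorded recorded ▸
           openLink 3 0 2
             (identify 3 0 2 4 13 recorded recorded ▸
              identify 3 2 0 10 12 recorded recorded ▸
              nonAdjacent 3 7 0 (recorded ∷ recorded ∷ (separatedBy 1) ∷ (separatedBy 1) ∷ []) ▸
              openLink 4 0 3
                (identify 4 0 3 5 15 recorded recorded ▸
                 identify 4 3 0 10 14 recorded recorded ▸
                 nonAdjacent 4 6 0 (recorded ∷ recorded ∷ byEdge ∷ recorded ∷ []) ▸
                 nonAdjacent 4 7 0 (recorded ∷ (separatedBy 1) ∷ (separatedBy 1) ∷ byEdge ∷ []) ▸
                 openLink 5 0 1
                   (identify 5 0 1 4 17 recorded recorded ▸
                    identify 5 1 0 7 16 recorded recorded ▸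
                    clash 7 4)
                   (identify 5 0 1 4 18 recorded recorded ▸
                    identify 5 1 0 7 16 recorded recorded ▸
                    identify 5 4 0 10 17 recorded recorded ▸
                    openLink 10 2 3
                      (identify 10 2 3 6 20 recorded recorded ▸
                       identify 10 3 2 4 19 recorded recorded ▸
                       clash 4 6)
                      (identify 10 2 3 6 21 recorded recorded ▸
                       identify 10 3 2 4 19 recorded recorded ▸
                       identify 10 4 3 5 20 recorded recorded ▸
                       clash 6 5)))
                (identify 4 0 3 5 16 recorded recorded ▸
                 identify 4 3 0 10 14 recorded recorded ▸
                 nonAdjacent 4 6 0 (recorded ∷ recorded ∷ byEdge ∷ (separatedBy′ 5) ∷ recorded ∷ []) ▸
                 nonAdjacent 2 15 2 (recorded ∷ (separatedBy 10) ∷ (separatedBy 4) ∷ byEdge ∷ recorded ∷ []) ▸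
                 openLink 5 0 1
                   (identify 5 0 1 4 18 recorded recorded ▸
                    identify 5 1 0 7 17 recorded recorded ▸
                    identify 5 4 0 7 15 recorded recorded ▸
                    openLink 7 1 5
                      (identify 7 1 5 6 20 recorded recorded ▸
                       identify 7 5 1 4 19 recorded recorded ▸
                       clash 4 6)
                      (identify 7 1 5 6 21 recorded recorded ▸
                       identify 7 5 1 4 19 recorded recorded ▸
                       identify 7 4 5 10 20 recorded recorded ▸
                       openLink 10 2 3
                         (identify 10 2 3 6 23 recorded recorded ▸
                          identify 10 3 2 4 22 recorded recorded ▸
                          clash 4 6)
                         (identify 10 2 3 6 24 recorded recorded ▸
                          identify 10 3 2 4 22 recorded recorded ▸
                          identify 10 4 3 7 23 recorded recorded ▸
                          openLink 6 1 2
                            (identify 6 1 2 7 26 recorded recorded ▸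
                             identify 6 2 1 10 25 recorded recorded ▸
                             match (# 3)
                               (0 ∷ 1 ∷ 2 ∷ 4 ∷ 7 ∷ 10 ∷ 5 ∷ 6 ∷ 3 ∷ [])
                               (8 ∷ 7 ∷ 6 ∷ 4 ∷ 2 ∷ 1 ∷ 3 ∷ 0 ∷ 5 ∷ [])
                               ((byEdge ∷ byEdge ∷ byEdge ∷ byEdge ∷ recorded ∷ recorded ∷ byEdge ∷ recorded ∷ byEdge ∷ []) ∷
                                (byEdge ∷ byEdge ∷ byEdge ∷ recorded ∷ byEdge ∷ recorded ∷ byEdge ∷ byEdge ∷ recorded ∷ []) ∷
                                (byEdge ∷ byEdge ∷ byEdge ∷ recorded ∷ recorded ∷ byEdge ∷ recorded ∷ byEdge ∷ byEdge ∷ []) ∷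
                                (byEdge ∷ recorded ∷ recorded ∷ byEdge ∷ byEdge ∷ byEdge ∷ byEdge ∷ recorded ∷ byEdge ∷ []) ∷
                                (recorded ∷ byEdge ∷ recorded ∷ byEdge ∷ byEdge ∷ byEdge ∷ byEdge ∷ byEdge ∷ recorded ∷ []) ∷
                                (recorded ∷ recorded ∷ byEdge ∷ byEdge ∷ byEdge ∷ byEdge ∷ recorded ∷ byEdge ∷ byEdge ∷ []) ∷
                                (byEdge ∷ byEdge ∷ recorded ∷ byEdge ∷ byEdge ∷ recorded ∷ byEdge ∷ recorded ∷ recorded ∷ []) ∷
                                (recorded ∷ byEdge ∷ byEdge ∷ recorded ∷ byEdge ∷ byEdge ∷ recorded ∷ byEdge ∷ recorded ∷ []) ∷
                                (byEdge ∷ recorded ∷ byEdge ∷ byEdge ∷ recorded ∷ byEdge ∷ recorded ∷ recorded ∷ byEdge ∷ []) ∷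
                                []))
                            (identify 6 1 2 7 27 recorded recorded ▸
                             identify 6 2 1 10 25 recorded recorded ▸
                             clash 7 10))))
                   (identify 5 0 1 4 19 recorded recorded ▸
                    identify 5 1 0 7 17 recorded recorded ▸
                    identify 5 4 0 15 18 recorded recorded ▸
                    openLink 10 2 3
                      (identify 10 2 3 6 21 recorded recorded ▸
                       identify 10 3 2 4 20 recorded recorded ▸
                       clash 4 6)
                      (identify 10 2 3 6 22 recorded recorded ▸
                       identify 10 3 2 4 20 recorded recorded ▸
                       identify 10 4 3 15 21 recorded recorded ▸
                       nonAdjacent 10 7 0 (recorded ∷ (separatedBy 1) ∷ recorded ∷ byEdge ∷ byEdge ∷ []) ▸
                       openLink 6 1 2
                         (identify 6 1 2 7 24 recorded recorded ▸
                          identify 6 2 1 10 23 recorded recorded ▸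
                          clash 7 10)
                         (identify 6 1 2 7 25 recorded recorded ▸
                          identify 6 2 1 10 23 recorded recorded ▸
                          identify 6 10 2 15 24 recorded recorded ▸
                          openLink 15 4 5
                            (identify 15 4 5 10 27 recorded recorded ▸
                             identify 15 5 4 7 26 recorded recorded ▸
                             clash 7 10)
                            (identify 15 4 5 10 28 recorded recorded ▸
                             identify 15 5 4 7 26 recorded recorded ▸
                             identify 15 7 5 6 27 recorded recorded ▸
                             openLink 7 1 5
                               (identify 7 1 5 6 30 recorded recorded ▸
                                identify 7 5 1 15 29 recorded recorded ▸
                                match (# 4)
                                  (3 ∷ 0 ∷ 2 ∷ 10 ∷ 4 ∷ 5 ∷ 1 ∷ 6 ∷ 15 ∷ 7 ∷ [])
                                  (6 ∷ 9 ∷ 7 ∷ 3 ∷ 5 ∷ 4 ∷ 8 ∷ 2 ∷ 1 ∷ 0 ∷ [])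
                                  ((byEdge ∷ byEdge ∷ byEdge ∷ byEdge ∷ byEdge ∷ recorded ∷ recorded ∷ recorded ∷ recorded ∷ (separatedBy 0) ∷ []) ∷
                                   (byEdge ∷ byEdge ∷ byEdge ∷ recorded ∷ byEdge ∷ byEdge ∷ byEdge ∷ recorded ∷ recorded ∷ recorded ∷ []) ∷
                                   (byEdge ∷ byEdge ∷ byEdge ∷ byEdge ∷ recorded ∷ recorded ∷ byEdge ∷ byEdge ∷ recorded ∷ recorded ∷ []) ∷
                                   (byEdge ∷ recorded ∷ byEdge ∷ byEdge ∷ byEdge ∷ recorded ∷ recorded ∷ byEdge ∷ byEdge ∷ recorded ∷ []) ∷
                                   (byEdge ∷ byEdge ∷ recorded ∷ byEdge ∷ byEdge ∷ byEdge ∷ recorded ∷ recorded ∷ byEdge ∷ recorded ∷ []) ∷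
                                   (recorded ∷ byEdge ∷ recorded ∷ recorded ∷ byEdge ∷ byEdge ∷ byEdge ∷ recorded ∷ byEdge ∷ byEdge ∷ []) ∷
                                   (recorded ∷ byEdge ∷ byEdge ∷ recorded ∷ recorded ∷ byEdge ∷ byEdge ∷ byEdge ∷ recorded ∷ byEdge ∷ []) ∷
                                   (recorded ∷ recorded ∷ byEdge ∷ byEdge ∷ recorded ∷ recorded ∷ byEdge ∷ byEdge ∷ byEdge ∷ byEdge ∷ []) ∷
                                   (recorded ∷ recorded ∷ recorded ∷ byEdge ∷ byEdge ∷ byEdge ∷ recorded ∷ byEdge ∷ byEdge ∷ byEdge ∷ []) ∷
                                   ((separatedBy 1) ∷ recorded ∷ recorded ∷ recorded ∷ recorded ∷ byEdge ∷ byEdge ∷ byEdge ∷ byEdge ∷ byEdge ∷ []) ∷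
                                   []))
                               (identify 7 1 5 6 31 recorded recorded ▸
                                identify 7 5 1 15 29 recorded recorded ▸
                                clash 6 15)))))))
             (identify 3 0 2 4 14 recorded recorded ▸
              identify 3 2 0 10 12 recorded recorded ▸
              openLink 4 0 3
                (identify 4 0 3 5 16 recorded recorded ▸
                 identify 4 3 0 13 15 recorded recorded ▸
                 nonAdjacent 4 6 0 (recorded ∷ recorded ∷ (separatedBy 2) ∷ recorded ∷ []) ▸
                 openLink 5 0 1
                   (identify 5 0 1 4 18 recorded recorded ▸
                    identify 5 1 0 7 17 recorded recorded ▸
                    identify 5 4 0 7 13 recorded recorded ▸
                    nonAdjacent 5 10 0 (recorded ∷ recorded ∷ byEdge ∷ recorded ∷ []) ▸
                    openLink 7 1 5
                      (identify 7 1 5 6 20 recorded recorded ▸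
                       identify 7 5 1 4 19 recorded recorded ▸
                       clash 4 6)
                      (identify 7 1 5 6 21 recorded recorded ▸
                       identify 7 5 1 4 19 recorded recorded ▸
                       identify 7 4 3 5 20 recorded (separatedBy 6) ▸
                       clash 5 1))
                   (identify 5 0 1 4 19 recorded recorded ▸
                    identify 5 1 0 7 17 recorded recorded ▸
                    identify 5 4 0 13 18 recorded recorded ▸
                    nonAdjacent 5 10 0 (recorded ∷ recorded ∷ (separatedBy 2) ∷ byEdge ∷ recorded ∷ []) ▸
                    nonAdjacent 3 7 2 (recorded ∷ recorded ∷ (separatedBy 1) ∷ byEdge ∷ recorded ∷ []) ▸
                    openLink 13 3 4
                      (identify 13 3 4 10 21 recorded recorded ▸
                       identify 13 4 3 5 20 recorded recorded ▸
                       clash 5 10)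
                      (identify 13 3 4 10 22 recorded recorded ▸
                       identify 13 4 3 5 20 recorded recorded ▸
                       identify 13 5 4 7 21 recorded recorded ▸
                       nonAdjacent 13 6 0 (recorded ∷ (separatedBy 1) ∷ recorded ∷ byEdge ∷ byEdge ∷ []) ▸
                       openLink 7 1 5
                         (identify 7 1 5 6 24 recorded recorded ▸
                          identify 7 5 1 13 23 recorded recorded ▸
                          clash 6 13)
                         (identify 7 1 5 6 25 recorded recorded ▸
                          identify 7 5 1 13 23 recorded recorded ▸
                          identify 7 13 5 10 24 recorded recorded ▸
                          openLink 10 2 3
                            (identify 10 2 3 6 27 recorded recorded ▸
                             identify 10 3 2 13 26 recorded recorded ▸
                             clash 6 13)
                            (identify 10 2 3 6 28 recorded recorded ▸
                             identify 10 3 2 13 26 recorded recorded ▸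
                             identify 10 13 3 7 27 recorded recorded ▸
                             openLink 6 1 2
                               (identify 6 1 2 7 30 recorded recorded ▸
                                identify 6 2 1 10 29 recorded recorded ▸
                                match (# 4)
                                  (4 ∷ 0 ∷ 3 ∷ 13 ∷ 5 ∷ 1 ∷ 2 ∷ 10 ∷ 7 ∷ 6 ∷ [])
                                  (5 ∷ 9 ∷ 6 ∷ 3 ∷ 4 ∷ 8 ∷ 7 ∷ 1 ∷ 2 ∷ 0 ∷ [])
                                  ((byEdge ∷ byEdge ∷ byEdge ∷ byEdge ∷ byEdge ∷ recorded ∷ recorded ∷ recorded ∷ recorded ∷ (separatedBy 0) ∷ []) ∷
                                   (byEdge ∷ byEdge ∷ byEdge ∷ recorded ∷ byEdge ∷ byEdge ∷ byEdge ∷ recorded ∷ recorded ∷ recorded ∷ []) ∷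
                                   (byEdge ∷ byEdge ∷ byEdge ∷ byEdge ∷ recorded ∷ recorded ∷ byEdge ∷ byEdge ∷ recorded ∷ recorded ∷ []) ∷
                                   (byEdge ∷ recorded ∷ byEdge ∷ byEdge ∷ byEdge ∷ recorded ∷ recorded ∷ byEdge ∷ byEdge ∷ recorded ∷ []) ∷
                                   (byEdge ∷ byEdge ∷ recorded ∷ byEdge ∷ byEdge ∷ byEdge ∷ recorded ∷ recorded ∷ byEdge ∷ recorded ∷ []) ∷
                                   (recorded ∷ byEdge ∷ recorded ∷ recorded ∷ byEdge ∷ byEdge ∷ byEdge ∷ recorded ∷ byEdge ∷ byEdge ∷ []) ∷
                                   (recorded ∷ byEdge ∷ byEdge ∷ recorded ∷ recorded ∷ byEdge ∷ byEdge ∷ byEdge ∷ recorded ∷ byEdge ∷ []) ∷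
                                   (recorded ∷ recorded ∷ byEdge ∷ byEdge ∷ recorded ∷ recorded ∷ byEdge ∷ byEdge ∷ byEdge ∷ byEdge ∷ []) ∷
                                   (recorded ∷ recorded ∷ recorded ∷ byEdge ∷ byEdge ∷ byEdge ∷ recorded ∷ byEdge ∷ byEdge ∷ byEdge ∷ []) ∷
                                   ((separatedBy 1) ∷ recorded ∷ recorded ∷ recorded ∷ recorded ∷ byEdge ∷ byEdge ∷ byEdge ∷ byEdge ∷ byEdge ∷ []) ∷
                                   []))
                               (identify 6 1 2 7 31 recorded recorded ▸
                                identify 6 2 1 10 29 recorded recorded ▸
                                clash 7 10))))))
                (identify 4 0 3 5 17 recorded recorded ▸
                 identify 4 3 0 13 15 recorded recorded ▸
                 nonAdjacent 4 6 0 (recorded ∷ recorded ∷ (separatedBy 2) ∷ (separatedBy′ 5) ∷ recorded ∷ []) ▸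
                 nonAdjacent 3 7 1 (recorded ∷ recorded ∷ (separatedBy 1) ∷ (separatedBy 5) ∷ (separatedBy 1) ∷ []) ▸
                 nonAdjacent 2 16 2 (recorded ∷ (separatedBy 4) ∷ (separatedBy 5) ∷ (separatedBy 4) ∷ recorded ∷ []) ▸
                 nonAdjacent 1 13 3 (recorded ∷ recorded ∷ (separatedBy 3) ∷ (separatedBy 3) ∷ recorded ∷ []) ▸
                 openLink 5 0 1
                   (identify 5 0 1 4 19 recorded recorded ▸
                    identify 5 1 0 7 18 recorded recorded ▸
                    identify 5 4 0 7 16 recorded recorded ▸
                    nonAdjacent 5 10 0 (recorded ∷ recorded ∷ (separatedBy 2) ∷ recorded ∷ []) ▸
                    openLink 7 1 5
                      (identify 7 1 5 6 21 recorded recorded ▸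
                       identify 7 5 1 4 20 recorded recorded ▸
                       clash 4 6)
                      (identify 7 1 5 6 22 recorded recorded ▸
                       identify 7 5 1 4 20 recorded recorded ▸
                       identify 7 4 5 13 21 recorded recorded ▸
                       nonAdjacent 7 10 0 (recorded ∷ (separatedBy 2) ∷ recorded ∷ byEdge ∷ byEdge ∷ []) ▸
                       openLink 6 1 2
                         (identify 6 1 2 7 24 recorded recorded ▸
                          identify 6 2 1 10 23 recorded recorded ▸
                          clash 7 10)
                         (identify 6 1 2 7 25 recorded recorded ▸
                          identify 6 2 1 10 23 recorded recorded ▸
                          identify 6 10 2 13 24 recorded recorded ▸
                          openLink 13 3 4
                            (identify 13 3 4 10 27 recorded recorded ▸
                             identify 13 4 3 7 26 recorded recorded ▸
                             clash 7 10)
                            (identify 13 3 4 10 28 recorded recorded ▸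
                             identify 13 4 3 7 26 recorded recorded ▸
                             identify 13 7 4 6 27 recorded recorded ▸
                             openLink 10 2 3
                               (identify 10 2 3 6 30 recorded recorded ▸
                                identify 10 3 2 13 29 recorded recorded ▸
                                match (# 4)
                                  (5 ∷ 0 ∷ 1 ∷ 7 ∷ 4 ∷ 3 ∷ 2 ∷ 6 ∷ 13 ∷ 10 ∷ [])
                                  (4 ∷ 9 ∷ 8 ∷ 3 ∷ 5 ∷ 6 ∷ 7 ∷ 2 ∷ 1 ∷ 0 ∷ [])
                                  ((byEdge ∷ byEdge ∷ byEdge ∷ byEdge ∷ byEdge ∷ recorded ∷ recorded ∷ recorded ∷ recorded ∷ (separatedBy 0) ∷ []) ∷
                                   (byEdge ∷ byEdge ∷ byEdge ∷ recorded ∷ byEdge ∷ byEdge ∷ byEdge ∷ recorded ∷ recorded ∷ recorded ∷ []) ∷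
                                   (byEdge ∷ byEdge ∷ byEdge ∷ byEdge ∷ recorded ∷ recorded ∷ byEdge ∷ byEdge ∷ recorded ∷ recorded ∷ []) ∷
                                   (byEdge ∷ recorded ∷ byEdge ∷ byEdge ∷ byEdge ∷ recorded ∷ recorded ∷ byEdge ∷ byEdge ∷ recorded ∷ []) ∷
                                   (byEdge ∷ byEdge ∷ recorded ∷ byEdge ∷ byEdge ∷ byEdge ∷ recorded ∷ recorded ∷ byEdge ∷ recorded ∷ []) ∷
                                   (recorded ∷ byEdge ∷ recorded ∷ recorded ∷ byEdge ∷ byEdge ∷ byEdge ∷ recorded ∷ byEdge ∷ byEdge ∷ []) ∷
                                   (recorded ∷ byEdge ∷ byEdge ∷ recorded ∷ recorded ∷ byEdge ∷ byEdge ∷ byEdge ∷ recorded ∷ byEdge ∷ []) ∷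
                                   (recorded ∷ recorded ∷ byEdge ∷ byEdge ∷ recorded ∷ recorded ∷ byEdge ∷ byEdge ∷ byEdge ∷ byEdge ∷ []) ∷
                                   (recorded ∷ recorded ∷ recorded ∷ byEdge ∷ byEdge ∷ byEdge ∷ recorded ∷ byEdge ∷ byEdge ∷ byEdge ∷ []) ∷
                                   ((separatedBy 2) ∷ recorded ∷ recorded ∷ recorded ∷ recorded ∷ byEdge ∷ byEdge ∷ byEdge ∷ byEdge ∷ byEdge ∷ []) ∷
                                   []))
                               (identify 10 2 3 6 31 recorded recorded ▸
                                identify 10 3 2 13 29 recorded recorded ▸
                                clash 6 13)))))
                   (identify 5 0 1 4 20 recorded recorded ▸
                    identify 5 1 0 7 18 recorded recorded ▸
                    identify 5 4 0 16 19 recorded recorded ▸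
                    nonAdjacent 5 10 0 (recorded ∷ recorded ∷ (separatedBy 2) ∷ (separatedBy 2) ∷ recorded ∷ []) ▸
                    openLink 6 1 2
                      (identify 6 1 2 7 22 recorded recorded ▸
                       identify 6 2 1 10 21 recorded recorded ▸
                       nonAdjacent 6 13 0 ((separatedBy 16) ∷ recorded ∷ byEdge ∷ (separatedBy 3) ∷ []) ▸
                       nonAdjacent 6 16 0 (recorded ∷ (separatedBy 5) ∷ (separatedBy 5) ∷ byEdge ∷ []) ▸
                       openLink 7 1 5
                         (identify 7 1 5 6 24 recorded recorded ▸
                          identify 7 5 1 16 23 recorded recorded ▸
                          clash 16 6)
                         (identify 7 1 5 6 25 recorded recorded ▸
                          identify 7 5 1 16 23 recorded recorded ▸
                          identify 7 6 1 10 24 recorded recorded ▸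
                          nonAdjacent 7 13 0 ((separatedBy 16) ∷ recorded ∷ byEdge ∷ byEdge ∷ (separatedBy 16) ∷ []) ▸
                          openLink 10 2 3
                            (identify 10 2 3 6 27 recorded recorded ▸
                             identify 10 3 2 13 26 recorded recorded ▸
                             clash 6 13)
                            (identify 10 2 3 6 28 recorded recorded ▸
                             identify 10 3 2 13 26 recorded recorded ▸
                             identify 10 13 3 16 27 recorded recorded ▸
                             clash 16 6)))
                      (identify 6 1 2 7 23 recorded recorded ▸
                       identify 6 2 1 10 21 recorded recorded ▸
                       nonAdjacent 0 22 6 (recorded ∷ recorded ∷ (separatedBy 6) ∷ (separatedBy 10) ∷ (separatedBy 10) ∷ []) ▸
                       openLink 7 1 5
                         (identify 7 1 5 6 25 recorded recorded ▸
                          identify 7 5 1 16 24 recorded recorded ▸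
                          identify 7 6 1 16 22 recorded recorded ▸
                          nonAdjacent 7 13 0 ((separatedBy 16) ∷ recorded ∷ byEdge ∷ (separatedBy 3) ∷ []) ▸
                          nonAdjacent 6 13 1 ((separatedBy 16) ∷ recorded ∷ byEdge ∷ byEdge ∷ (separatedBy 10) ∷ []) ▸
                          openLink 16 4 5
                            (identify 16 4 5 13 27 recorded recorded ▸
                             identify 16 5 4 7 26 recorded recorded ▸
                             clash 7 13)
                            (identify 16 4 5 13 28 recorded recorded ▸
                             identify 16 5 4 7 26 recorded recorded ▸
                             identify 16 7 5 6 27 recorded recorded ▸
                             clash 6 13))
                         (identify 7 1 5 6 26 recorded recorded ▸
                          identify 7 5 1 16 24 recorded recorded ▸
                          identify 7 6 1 22 25 recorded recorded ▸
                          openLink 10 2 3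
                            (identify 10 2 3 6 28 recorded recorded ▸
                             identify 10 3 2 13 27 recorded recorded ▸
                             identify 10 6 2 13 22 recorded recorded ▸
                             nonAdjacent 10 16 0 ((separatedBy 5) ∷ recorded ∷ byEdge ∷ recorded ∷ []) ▸
                             openLink 13 3 4
                               (identify 13 3 4 10 30 recorded recorded ▸
                                identify 13 4 3 16 29 recorded recorded ▸
                                clash 10 16)
                               (identify 13 3 4 10 31 recorded recorded ▸
                                identify 13 4 3 16 29 recorded recorded ▸
                                identify 13 16 4 7 30 recorded recorded ▸
                                clash 7 10))
                            (identify 10 2 3 6 29 recorded recorded ▸
                             identify 10 3 2 13 27 recorded recorded ▸
                             identify 10 6 2 22 28 recorded recorded ▸
                             nonAdjacent 10 16 0 ((separatedBy 4) ∷ recorded ∷ byEdge ∷ byEdge ∷ recorded ∷ []) ▸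
                             nonAdjacent 7 13 1 ((separatedBy 3) ∷ recorded ∷ byEdge ∷ byEdge ∷ recorded ∷ []) ▸
                             nonAdjacent 4 22 4 ((separatedBy 6) ∷ recorded ∷ byEdge ∷ byEdge ∷ recorded ∷ []) ▸
                             openLink 13 3 4
                               (identify 13 3 4 10 31 recorded recorded ▸
                                identify 13 4 3 16 30 recorded recorded ▸
                                clash 10 16)
                               (identify 13 3 4 10 32 recorded recorded ▸
                                identify 13 4 3 16 30 recorded recorded ▸
                                identify 13 16 4 22 31 (separatedBy 6) recorded ▸
                                openLink 16 4 5
                                  (identify 16 4 5 13 34 recorded recorded ▸
                                   identify 16 5 33 4 7 recorded (separatedBy′ 13) ▸
                                   clash 4 0)
                                  (identify 16 4 5 13 35 recorded recorded ▸
                                   identify 16 5 4 7 33 recorded recorded ▸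
                                   identify 16 7 5 22 34 recorded recorded ▸
                                   openLink 22 6 7
                                     (identify 22 6 7 10 37 recorded recorded ▸
                                      identify 22 7 36 6 16 recorded (separatedBy′ 10) ▸
                                      clash 4 6)
                                     (identify 22 6 7 10 38 recorded recorded ▸
                                      identify 22 7 6 16 36 recorded recorded ▸
                                      identify 22 16 7 13 37 recorded recorded ▸
                                      match (# 5)
                                        (0 ∷ 1 ∷ 2 ∷ 3 ∷ 4 ∷ 5 ∷ 7 ∷ 6 ∷ 10 ∷ 13 ∷ 16 ∷ 22 ∷ [])
                                        (11 ∷ 10 ∷ 9 ∷ 8 ∷ 7 ∷ 6 ∷ 4 ∷ 5 ∷ 3 ∷ 2 ∷ 1 ∷ 0 ∷ [])
                                        ((byEdge ∷ byEdge ∷ byEdge ∷ byEdge ∷ byEdge ∷ byEdge ∷ recorded ∷ recorded ∷ recorded ∷ recorded ∷ recorded ∷ (separatedBy 1) ∷ []) ∷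
                                         (byEdge ∷ byEdge ∷ byEdge ∷ recorded ∷ recorded ∷ byEdge ∷ byEdge ∷ byEdge ∷ recorded ∷ (separatedBy 0) ∷ recorded ∷ recorded ∷ []) ∷
                                         (byEdge ∷ byEdge ∷ byEdge ∷ byEdge ∷ recorded ∷ recorded ∷ recorded ∷ byEdge ∷ byEdge ∷ recorded ∷ (separatedBy 0) ∷ recorded ∷ []) ∷
                                         (byEdge ∷ recorded ∷ byEdge ∷ byEdge ∷ byEdge ∷ recorded ∷ (separatedBy 0) ∷ recorded ∷ byEdge ∷ byEdge ∷ recorded ∷ recorded ∷ []) ∷
                                         (byEdge ∷ recorded ∷ recorded ∷ byEdge ∷ byEdge ∷ byEdge ∷ recorded ∷ (separatedBy 0) ∷ recorded ∷ byEdge ∷ byEdge ∷ recorded ∷ []) ∷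
                                         (byEdge ∷ byEdge ∷ recorded ∷ recorded ∷ byEdge ∷ byEdge ∷ byEdge ∷ recorded ∷ (separatedBy 0) ∷ recorded ∷ byEdge ∷ recorded ∷ []) ∷
                                         (recorded ∷ byEdge ∷ recorded ∷ (separatedBy 1) ∷ recorded ∷ byEdge ∷ byEdge ∷ byEdge ∷ recorded ∷ recorded ∷ byEdge ∷ byEdge ∷ []) ∷
                                         (recorded ∷ byEdge ∷ byEdge ∷ recorded ∷ (separatedBy 1) ∷ recorded ∷ byEdge ∷ byEdge ∷ byEdge ∷ recorded ∷ recorded ∷ byEdge ∷ []) ∷
                                         (recorded ∷ recorded ∷ byEdge ∷ byEdge ∷ recorded ∷ (separatedBy 2) ∷ recorded ∷ byEdge ∷ byEdge ∷ byEdge ∷ recorded ∷ byEdge ∷ []) ∷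
                                         (recorded ∷ (separatedBy 3) ∷ recorded ∷ byEdge ∷ byEdge ∷ recorded ∷ recorded ∷ recorded ∷ byEdge ∷ byEdge ∷ byEdge ∷ byEdge ∷ []) ∷
                                         (recorded ∷ recorded ∷ (separatedBy 4) ∷ recorded ∷ byEdge ∷ byEdge ∷ byEdge ∷ recorded ∷ recorded ∷ byEdge ∷ byEdge ∷ byEdge ∷ []) ∷
                                         ((separatedBy 6) ∷ recorded ∷ recorded ∷ recorded ∷ recorded ∷ recorded ∷ byEdge ∷ byEdge ∷ byEdge ∷ byEdge ∷ byEdge ∷ byEdge ∷ []) ∷
                                         [])))))))))))))

certificate-valid : valid triangle₀ certificate ≡ true
certificate-valid = refl

-- Every connected positively curved 2-graph is one of the six deltahedra:
-- name a triangle through some vertex and run the certificate.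
classification : ∀ G → Connected G → TwoGraph G → PositiveCurvature G → ∃ λ t → G ≅ deltahedron t
classification G (0<n , connected) two pc = sound certificate start certificate-valid
  where
  open GraphFacts G
  open TwoGraphStructure G two using (triangle-at)
  open Soundness G two pc connected
  v : V
  v = fromℕ< 0<n
  i j : V
  i = proj₁ (triangle-at v)
  j = proj₁ (proj₂ (triangle-at v))
  name : Naming
  name zero = v
  name (suc zero) = i
  name (suc (suc _)) = j
  start : Holds name triangle₀
  start = let vi , vj , ij = proj₂ (proj₂ (triangle-at v)) in holds (vi ∷ vj ∷ ij ∷ []) [] [] []

mainTheorem2 : Σ (Fin 6 → Graph) λ L →
    (∀ i → Connected (L i) × TwoGraph (L i) × PositiveCurvature (L i))
    × (∀ i j → L i ≅ L j → i ≡ j)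
    × (∀ G → Connected G → TwoGraph G → PositiveCurvature G → ∃ λ i → G ≅ L i)
mainTheorem2 = deltahedron , deltahedron-properties , deltahedra-distinct , classification
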